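{- Let $h,k$ be integers with $2\le h\le k$. Then $$h(C_{2h+1}\boxtimes C_{2k+1})=\begin{cases}2,&\text{if } h<k,\\ 3,&\text{if } h=k.\end{cases}$$
   Context: $C_n$ denotes the cycle of order $n$. For a connected graph, $I[x,y]$ consists of $x$, $y$ and all vertices on some shortest $x$–$y$ path; $I[S]=\bigcup_{u,v\in S}I[u,v]$. $S$ is convex if $I[S]=S$; $CH(S)$ is the smallest convex set containing $S$; $S$ is a hull set if $CH(S)$ is the whole vertex set, and the hull number $h(\cdot)$ is the minimum size of a hull set (note: $h(\cdot)$ denotes the hull number, while the letters $h,k$ in the statement are integers). The strong product $G\boxtimes H$ has vertex set $V(G)\times V(H)$, with $(g,h)$ and $(g',h')$ adjacent whenever ($g=g'$ and $hh'\in E(H)$), or ($h=h'$ and $gg'\in E(G)$), or ($gg'\in E(G)$ and $hh'\in E(H)$). -}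

module Defs where

open import Level using (Level; _⊔_) renaming (suc to lsuc; zero to lzero)
open import Data.Nat using (ℕ; zero; suc; _+_; _*_; _≤_; _<_; _%_; NonZero)
open import Data.Fin using (Fin; toℕ)
open import Data.Product using (Σ; ∃; ∃-syntax; _×_; _,_)
open import Data.Sum using (_⊎_)
open import Data.List using (List; []; _∷_; length)
open import Data.List.Membership.Propositional using (_∈_)
open import Data.List.Relation.Unary.Unique.Propositional using (Unique)
open import Relation.Binary.PropositionalEquality using (_≡_)

record Graph : Set₁ where
  field
    V : Set
    E : V → V → Set
open Graph public

-- The cycle C_n on vertices 0,…,n-1 (intended for n ≥ 3):
-- i ~ j iff j ≡ i+1 (mod n) or i ≡ j+1 (mod n).
C : (n : ℕ) → .{{_ : NonZero n}} → Graph
C n = record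
  { V = Fin n
  ; E = λ i j → (toℕ j ≡ (toℕ i + 1) % n) ⊎ (toℕ i ≡ (toℕ j + 1) % n)
  }

_⊠_ : Graph → Graph → Graph
G ⊠ H = record
  { V = V G × V H
  ; E = λ { (g , h) (g' , h') →
        ((g ≡ g') × E H h h')
      ⊎ ((h ≡ h') × E G g g')
      ⊎ (E G g g' × E H h h') }
  }

module _ (G : Graph) where

  data Walk : V G → V G → List (V G) → Set where
    here : ∀ {x} → Walk x x (x ∷ [])
    step : ∀ {x y z vs} → E G x y → Walk y z vs → Walk x z (x ∷ vs)

  ShortestPath : V G → V G → List (V G) → Set
  ShortestPath x y vs = Walk x y vs × (∀ ws → Walk x y ws → length vs ≤ length ws)

  Interval : V G → V G → V G → Set
  Interval x y z = (z ≡ x) ⊎ (z ≡ y) ⊎ (∃[ vs ] (ShortestPath x y vs × z ∈ vs))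

  IntervalSet : (V G → Set) → V G → Set
  IntervalSet S z = ∃[ u ] ∃[ v ] (S u × S v × Interval u v z)

  -- S is convex iff I[S] = S (I[S] ⊇ S always holds since x ∈ I[x,x]).
  Convex : (V G → Set) → Set
  Convex S = ∀ z → IntervalSet S z → S z

  -- A list of vertices S is a hull set iff CH(S) = V(G), i.e. every convex set
  -- containing S (hence the smallest such, CH(S)) is the whole vertex set.
  IsHullSet : List (V G) → Set₁
  IsHullSet S = (T : V G → Set) → Convex T → (∀ s → s ∈ S → T s) → ∀ v → T v

  HullNumber : ℕ → Set₁
  HullNumber m =
    (∃[ S ] (Unique S × length S ≡ m × IsHullSet S))
    × (∀ S → Unique S → IsHullSet S → m ≤ length S)

module Submission where

open import Defs
open import Data.Nat using (ℕ; zero; suc; z≤n; s≤s)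
import Data.Nat as ℕ
import Data.Nat.Properties as ℕₚ
import Data.Nat.Tactic.RingSolver as ℕ-solver
open import Data.Integer using (ℤ; ∣_∣; 0ℤ; 1ℤ; -1ℤ)
import Data.Integer.Properties as ℤₚ
open import Data.Integer.Tactic.RingSolver using (solve-∀)
open import Data.Fin using (toℕ)
open import Data.Product using (∃; ∃-syntax; _×_; _,_; proj₁; proj₂)
open import Data.Sum using (_⊎_; inj₁; inj₂)
open import Data.Empty using (⊥; ⊥-elim)
open import Data.List using (List; []; _∷_; length; _++_)
open import Data.List.Membership.Propositional using (_∈_)
open import Data.List.Relation.Unary.Any using (here; there)
open import Relation.Nullary using (¬_; yes; no)
open import Relation.Binary.PropositionalEquality

-- The strong product of two odd cycles is a discrete torus whose distance is the
-- Chebyshev distance of the signed coordinate displacements in [-h, h] (OddCycle,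
-- Torus).  Upper bounds: a convex set absorbs shortest paths and, as h ≥ 2, common
-- neighbours of vertices two columns (rows) apart, so a full row (column) spreads over
-- the torus (TorusConvexSets).  For h < k the diagonal and antidiagonal shortest
-- (0,0)–(h,k) paths generate a cone whose top row is a full row (TwoVertexHull); for
-- h = k two vertical shortest paths through (0,0), (0,1), (0,h+1) cover a column
-- (ThreeVertexHull).  Lower bounds: singletons are convex (GraphFacts); for h = k all
-- distances are at most h, so a metric interval {t | d u t + d t v = d u v} lifts to
-- the Chebyshev plane ℤ², where metric intervals are convex because in the rotated
-- coordinates x + y, x - y betweenness splits into betweenness on two lines
-- (IntegerBetweenness, ChebyshevPlane).  Such an interval is thus a convex set
-- containing u and v but missing a vertex at distance h from u (SquareTorusIntervals).

module ≤-Arithmetic where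
  open import Data.Nat using (_+_; _≤_)

  ≤-split : ∀ {x y u v} → x + y ≤ u + v → u ≤ x → v ≤ y → x ≤ u × y ≤ v
  ≤-split {x} {y} {u} {v} le u≤x v≤y =
      ℕₚ.+-cancelʳ-≤ y x u (ℕₚ.≤-trans le (ℕₚ.+-monoʳ-≤ u v≤y))
    , ℕₚ.+-cancelˡ-≤ x y v (ℕₚ.≤-trans le (ℕₚ.+-monoˡ-≤ v u≤x))

module Halving where
  open import Data.Nat using (_+_; _≤_; _<_)

  halve : ∀ j → ∃[ a ] (j ≡ a + a ⊎ j ≡ suc (a + a))
  halve zero    = 0 , inj₁ refl
  halve (suc j) with halve j
  ... | a , inj₁ j≡a+a = a , inj₂ (cong suc j≡a+a)
  ... | a , inj₂ j≡1+a+a = suc a , inj₁ (cong suc (trans j≡1+a+a (sym (ℕₚ.+-suc a a))))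

  half-≤ : ∀ a m → a + a ≤ m + m → a ≤ m
  half-≤ a m le = ℕₚ.≮⇒≥ (λ m<a → ℕₚ.<⇒≱ (ℕₚ.+-mono-< m<a m<a) le)

  half-< : ∀ a m → suc (a + a) ≤ m + m → a < m
  half-< a m le = ℕₚ.≰⇒> (λ m≤a → ℕₚ.<-irrefl refl (ℕₚ.≤-trans le (ℕₚ.+-mono-≤ m≤a m≤a)))

module MetricWidth {X : Set} (d : X → X → ℕ)
                   (d-sym : ∀ x y → d x y ≡ d y x)
                   (d-triangle : ∀ x y z → d x z ℕ.≤ d x y ℕ.+ d y z) where
  open import Data.Nat using (_+_; _*_; _≤_)

  -- Two points lying metrically between a and c are at most d a c apart:
  -- 2·d z z' ≤ (d a z + d z c) + (d a z' + d z' c) ≤ 2·d a c.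
  width : ∀ {a c z z'} → d a z + d z c ≤ d a c → d a z' + d z' c ≤ d a c → d z z' ≤ d a c
  width {a} {c} {z} {z'} le le' = ℕₚ.*-cancelˡ-≤ 2 (begin
      2 * d z z'                          ≡⟨⟩
      d z z' + (d z z' + 0)               ≤⟨ ℕₚ.+-mono-≤ (d-triangle z a z') (ℕₚ.≤-reflexive (ℕₚ.+-identityʳ _)) ⟩
      (d z a + d a z') + d z z'           ≤⟨ ℕₚ.+-monoʳ-≤ (d z a + d a z') (d-triangle z c z') ⟩
      (d z a + d a z') + (d z c + d c z') ≡⟨ cong₂ (λ s t → (s + d a z') + (d z c + t)) (d-sym z a) (d-sym c z') ⟩
      (d a z + d a z') + (d z c + d z' c) ≡⟨ swap (d a z) (d a z') (d z c) (d z' c) ⟩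
      (d a z + d z c) + (d a z' + d z' c) ≤⟨ ℕₚ.+-mono-≤ le le' ⟩
      d a c + d a c                       ≡⟨ cong (λ t → d a c + t) (sym (ℕₚ.+-identityʳ (d a c))) ⟩
      2 * d a c                           ∎)
    where
    open ℕₚ.≤-Reasoning
    swap : ∀ a b c e → (a + b) + (c + e) ≡ (a + c) + (b + e)
    swap = ℕ-solver.solve-∀

module IntegerBetweenness where
  open import Data.Integer using (+_; -[1+_]; +≤+; -≤+; _+_; _-_; -_; _≤_; _⊓_; _⊔_)

  Between : ℤ → ℤ → ℤ → Set
  Between a b c = ∣ b - a ∣ ℕ.+ ∣ c - b ∣ ℕ.≤ ∣ c - a ∣

  SameSign : ℤ → ℤ → Set
  SameSign x y = (0ℤ ≤ x × 0ℤ ≤ y) ⊎ (x ≤ 0ℤ × y ≤ 0ℤ)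

  telescope : ∀ a b c → (b - a) + (c - b) ≡ c - a
  telescope = solve-∀

  abs-triangle : ∀ a b c → ∣ c - a ∣ ℕ.≤ ∣ b - a ∣ ℕ.+ ∣ c - b ∣
  abs-triangle a b c =
    subst (λ s → ∣ s ∣ ℕ.≤ ∣ b - a ∣ ℕ.+ ∣ c - b ∣) (telescope a b c) (ℤₚ.∣i+j∣≤∣i∣+∣j∣ (b - a) (c - b))

  sameSign⇒abs-+ : ∀ {x y} → SameSign x y → ∣ x + y ∣ ≡ ∣ x ∣ ℕ.+ ∣ y ∣
  sameSign⇒abs-+ (inj₁ (+≤+ _ , +≤+ _)) = refl
  sameSign⇒abs-+ {x} {y} (inj₂ (x≤0 , y≤0)) = begin
    ∣ x + y ∣                 ≡⟨ sym (ℤₚ.∣-i∣≡∣i∣ (x + y)) ⟩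
    ∣ - (x + y) ∣             ≡⟨ cong ∣_∣ (ℤₚ.neg-distrib-+ x y) ⟩
    ∣ - x + - y ∣             ≡⟨ nonnegative (ℤₚ.neg-mono-≤ x≤0) (ℤₚ.neg-mono-≤ y≤0) ⟩
    ∣ - x ∣ ℕ.+ ∣ - y ∣       ≡⟨ cong₂ ℕ._+_ (ℤₚ.∣-i∣≡∣i∣ x) (ℤₚ.∣-i∣≡∣i∣ y) ⟩
    ∣ x ∣ ℕ.+ ∣ y ∣           ∎
    where
    open ≡-Reasoning
    nonnegative : ∀ {x y} → 0ℤ ≤ x → 0ℤ ≤ y → ∣ x + y ∣ ≡ ∣ x ∣ ℕ.+ ∣ y ∣
    nonnegative (+≤+ _) (+≤+ _) = refl

  max<sum : ∀ m n → ¬ (suc m ℕ.+ suc n ℕ.≤ suc m ℕ.⊔ suc n)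
  max<sum m n le = ℕₚ.<-irrefl refl (begin-strict
    suc m ℕ.+ n      <⟨ ℕₚ.+-monoʳ-< (suc m) (ℕₚ.n<1+n n) ⟩
    suc m ℕ.+ suc n  ≤⟨ le ⟩
    suc (m ℕ.⊔ n)    ≤⟨ s≤s (ℕₚ.m⊔n≤m+n m n) ⟩
    suc m ℕ.+ n      ∎)
    where open ℕₚ.≤-Reasoning

  -- ... and only for them: for numbers of strictly opposite signs the triangle
  -- inequality is strict, since |a - b| ≤ max a b < a + b for positive a, b.
  abs-+⇒sameSign : ∀ x y → ∣ x ∣ ℕ.+ ∣ y ∣ ℕ.≤ ∣ x + y ∣ → SameSign x y
  abs-+⇒sameSign (+ m)      (+ n)      _  = inj₁ (+≤+ z≤n , +≤+ z≤n)
  abs-+⇒sameSign -[1+ m ]   -[1+ n ]   _  = inj₂ (-≤+ , -≤+)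
  abs-+⇒sameSign (+ zero)   -[1+ n ]   _  = inj₂ (+≤+ z≤n , -≤+)
  abs-+⇒sameSign -[1+ m ]   (+ zero)   _  = inj₂ (-≤+ , +≤+ z≤n)
  abs-+⇒sameSign (+ suc m)  -[1+ n ]   le =
    ⊥-elim (max<sum m n (ℕₚ.≤-trans le (ℤₚ.∣m⊝n∣≤m⊔n (suc m) (suc n))))
  abs-+⇒sameSign -[1+ m ]   (+ suc n)  le =
    ⊥-elim (max<sum n m (subst (ℕ._≤ suc n ℕ.⊔ suc m) (ℕₚ.+-comm (suc m) (suc n))
                           (ℕₚ.≤-trans le (ℤₚ.∣m⊝n∣≤m⊔n (suc n) (suc m)))))

  Between⇒sameSign : ∀ {a b c} → Between a b c → SameSign (b - a) (c - b)
  Between⇒sameSign {a} {b} {c} le =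
    abs-+⇒sameSign (b - a) (c - b) (subst (λ s → ∣ b - a ∣ ℕ.+ ∣ c - b ∣ ℕ.≤ ∣ s ∣) (sym (telescope a b c)) le)

  ordered⇒Between : ∀ {a b c} → a ≤ b → b ≤ c → Between a b c
  ordered⇒Between {a} {b} {c} a≤b b≤c = ℕₚ.≤-reflexive (begin
    ∣ b - a ∣ ℕ.+ ∣ c - b ∣  ≡⟨ sameSign⇒abs-+ (inj₁ (ℤₚ.i≤j⇒0≤j-i a≤b , ℤₚ.i≤j⇒0≤j-i b≤c)) ⟨
    ∣ (b - a) + (c - b) ∣    ≡⟨ cong ∣_∣ (telescope a b c) ⟩
    ∣ c - a ∣                ∎)
    where open ≡-Reasoning

  Between-sym : ∀ {a b c} → Between a b c → Between c b a
  Between-sym {a} {b} {c} le =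
    subst₂ ℕ._≤_ (trans (ℕₚ.+-comm ∣ b - a ∣ ∣ c - b ∣) (cong₂ ℕ._+_ (ℤₚ.∣i-j∣≡∣j-i∣ c b) (ℤₚ.∣i-j∣≡∣j-i∣ b a)))
                 (ℤₚ.∣i-j∣≡∣j-i∣ c a) le

  Between⇒bounds : ∀ {a b c} → Between a b c → a ⊓ c ≤ b × b ≤ a ⊔ c
  Between⇒bounds {a} {b} {c} le with Between⇒sameSign {a} {b} {c} le
  ... | inj₁ (0≤b-a , 0≤c-b) = ℤₚ.≤-trans (ℤₚ.i⊓j≤i a c) (ℤₚ.0≤i-j⇒j≤i 0≤b-a)
                              , ℤₚ.≤-trans (ℤₚ.0≤i-j⇒j≤i 0≤c-b) (ℤₚ.i≤j⊔i a c)
  ... | inj₂ (b-a≤0 , c-b≤0) = ℤₚ.≤-trans (ℤₚ.i⊓j≤j a c) (ℤₚ.i-j≤0⇒i≤j c-b≤0)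
                              , ℤₚ.≤-trans (ℤₚ.i-j≤0⇒i≤j b-a≤0) (ℤₚ.i≤i⊔j a c)

  bounds⇒Between : ∀ {a b c} → a ⊓ c ≤ b → b ≤ a ⊔ c → Between a b c
  bounds⇒Between {a} {b} {c} lo hi with ℤₚ.≤-total a c
  ... | inj₁ a≤c = ordered⇒Between (subst (_≤ b) (ℤₚ.i≤j⇒i⊓j≡i a≤c) lo) (subst (b ≤_) (ℤₚ.i≤j⇒i⊔j≡j a≤c) hi)
  ... | inj₂ c≤a = Between-sym {c} {b} {a} (ordered⇒Between (subst (_≤ b) (ℤₚ.i≥j⇒i⊓j≡j c≤a) lo)
                                                (subst (b ≤_) (ℤₚ.i≥j⇒i⊔j≡i c≤a) hi))

  Between-convex : ∀ {a c z z' t} → Between a z c → Between a z' c → Between z t z' → Between a t c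
  Between-convex {a} {c} {z} {z'} {t} z∈ z'∈ t∈ = bounds⇒Between
      (ℤₚ.≤-trans (ℤₚ.⊓-glb (proj₁ z-bounds) (proj₁ z'-bounds)) (proj₁ t-bounds))
      (ℤₚ.≤-trans (proj₂ t-bounds) (ℤₚ.⊔-lub (proj₂ z-bounds) (proj₂ z'-bounds)))
    where
    z-bounds  : a ⊓ c ≤ z × z ≤ a ⊔ c
    z-bounds  = Between⇒bounds {a} {z} {c} z∈
    z'-bounds : a ⊓ c ≤ z' × z' ≤ a ⊔ c
    z'-bounds = Between⇒bounds {a} {z'} {c} z'∈
    t-bounds  : z ⊓ z' ≤ t × t ≤ z ⊔ z'
    t-bounds  = Between⇒bounds {z} {t} {z'} t∈

-- Rotating coordinates by
-- (x , y) ↦ (x + y , x - y) turns it into (twice) the ℓ¹ plane, where metric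
-- betweenness splits into betweenness on the two coordinate lines.
module ChebyshevPlane where
  open import Data.Integer using (+_; _+_; _-_; -_; _*_; _≤_)
  open IntegerBetweenness
  open ≤-Arithmetic

  Point : Set
  Point = ℤ × ℤ

  ∥_∥ : Point → ℕ
  ∥ (x , y) ∥ = ∣ x ∣ ℕ.⊔ ∣ y ∣

  infixl 6 _⊕_ _⊖_
  _⊕_ _⊖_ : Point → Point → Point
  (x , y) ⊕ (x' , y') = (x + x' , y + y')
  (x , y) ⊖ (x' , y') = (x - x' , y - y')

  dist : Point → Point → ℕ
  dist A B = ∥ B ⊖ A ∥

  Between² : Point → Point → Point → Set
  Between² A B C = dist A B ℕ.+ dist B C ℕ.≤ dist A C

  p q : Point → ℤ
  p (x , y) = x + y
  q (x , y) = x - y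

  sign-cases : ∀ u v → SameSign u v ⊎ SameSign u (- v)
  sign-cases u v with ℤₚ.≤-total 0ℤ u | ℤₚ.≤-total 0ℤ v
  ... | inj₁ 0≤u | inj₁ 0≤v = inj₁ (inj₁ (0≤u , 0≤v))
  ... | inj₁ 0≤u | inj₂ v≤0 = inj₂ (inj₁ (0≤u , ℤₚ.neg-mono-≤ v≤0))
  ... | inj₂ u≤0 | inj₁ 0≤v = inj₂ (inj₂ (u≤0 , ℤₚ.neg-mono-≤ 0≤v))
  ... | inj₂ u≤0 | inj₂ v≤0 = inj₁ (inj₂ (u≤0 , v≤0))

  -- |u| + |v| = max (|u + v|) (|u - v|): one of u ± v adds absolute values,
  -- the other one is bounded by the triangle inequality.
  abs-+-abs : ∀ u v → ∣ u ∣ ℕ.+ ∣ v ∣ ≡ ∣ u + v ∣ ℕ.⊔ ∣ u - v ∣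
  abs-+-abs u v with sign-cases u v
  ... | inj₁ same = sym (trans (ℕₚ.m≥n⇒m⊔n≡m (subst (∣ u - v ∣ ℕ.≤_) (sym sum) (ℤₚ.∣i-j∣≤∣i∣+∣j∣ u v))) sum)
    where
    sum : ∣ u + v ∣ ≡ ∣ u ∣ ℕ.+ ∣ v ∣
    sum = sameSign⇒abs-+ same
  ... | inj₂ same = sym (trans (ℕₚ.m≤n⇒m⊔n≡n (subst (∣ u + v ∣ ℕ.≤_) (sym difference) (ℤₚ.∣i+j∣≤∣i∣+∣j∣ u v)))
                               difference)
    where
    difference : ∣ u - v ∣ ≡ ∣ u ∣ ℕ.+ ∣ v ∣
    difference = trans (sameSign⇒abs-+ same) (cong (∣ u ∣ ℕ.+_) (ℤₚ.∣-i∣≡∣i∣ v))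

  twice-max : ∀ u v → 2 ℕ.* (∣ u ∣ ℕ.⊔ ∣ v ∣) ≡ ∣ u + v ∣ ℕ.+ ∣ u - v ∣
  twice-max u v = sym (begin
    ∣ u + v ∣ ℕ.+ ∣ u - v ∣                          ≡⟨ abs-+-abs (u + v) (u - v) ⟩
    ∣ (u + v) + (u - v) ∣ ℕ.⊔ ∣ (u + v) - (u - v) ∣  ≡⟨ cong₂ (λ s t → ∣ s ∣ ℕ.⊔ ∣ t ∣) (sum u v) (difference u v) ⟩
    ∣ + 2 * u ∣ ℕ.⊔ ∣ + 2 * v ∣                      ≡⟨ cong₂ ℕ._⊔_ (ℤₚ.abs-* (+ 2) u) (ℤₚ.abs-* (+ 2) v) ⟩
    2 ℕ.* ∣ u ∣ ℕ.⊔ 2 ℕ.* ∣ v ∣                      ≡⟨ ℕₚ.*-distribˡ-⊔ 2 ∣ u ∣ ∣ v ∣ ⟨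
    2 ℕ.* (∣ u ∣ ℕ.⊔ ∣ v ∣)                          ∎)
    where
    open ≡-Reasoning
    sum : ∀ u v → (u + v) + (u - v) ≡ + 2 * u
    sum = solve-∀
    difference : ∀ u v → (u + v) - (u - v) ≡ + 2 * v
    difference = solve-∀

  twice-dist : ∀ A B → 2 ℕ.* dist A B ≡ ∣ p B - p A ∣ ℕ.+ ∣ q B - q A ∣
  twice-dist (x , y) (x' , y') =
    trans (twice-max (x' - x) (y' - y)) (cong₂ (λ s t → ∣ s ∣ ℕ.+ ∣ t ∣) (rot-p x y x' y') (rot-q x y x' y'))
    where
    rot-p : ∀ x y x' y' → (x' - x) + (y' - y) ≡ (x' + y') - (x + y)
    rot-p = solve-∀
    rot-q : ∀ x y x' y' → (x' - x) - (y' - y) ≡ (x' - y') - (x - y)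
    rot-q = solve-∀

  twice-path : ∀ A B C → 2 ℕ.* (dist A B ℕ.+ dist B C)
                         ≡ (∣ p B - p A ∣ ℕ.+ ∣ p C - p B ∣) ℕ.+ (∣ q B - q A ∣ ℕ.+ ∣ q C - q B ∣)
  twice-path A B C = begin
    2 ℕ.* (dist A B ℕ.+ dist B C)              ≡⟨ ℕₚ.*-distribˡ-+ 2 (dist A B) (dist B C) ⟩
    2 ℕ.* dist A B ℕ.+ 2 ℕ.* dist B C          ≡⟨ cong₂ ℕ._+_ (twice-dist A B) (twice-dist B C) ⟩
    (∣ p B - p A ∣ ℕ.+ ∣ q B - q A ∣) ℕ.+ (∣ p C - p B ∣ ℕ.+ ∣ q C - q B ∣)
      ≡⟨ interchange (∣ p B - p A ∣) (∣ q B - q A ∣) (∣ p C - p B ∣) (∣ q C - q B ∣) ⟩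
    (∣ p B - p A ∣ ℕ.+ ∣ p C - p B ∣) ℕ.+ (∣ q B - q A ∣ ℕ.+ ∣ q C - q B ∣) ∎
    where
    open ≡-Reasoning
    interchange : ∀ a b c e → (a ℕ.+ b) ℕ.+ (c ℕ.+ e) ≡ (a ℕ.+ c) ℕ.+ (b ℕ.+ e)
    interchange = ℕ-solver.solve-∀

  -- Hence B lies between A and C in the plane iff it does so in both rotated
  -- coordinates: the doubled inequality splits since each coordinate satisfies the
  -- triangle inequality.
  Between²⇒rotated : ∀ A B C → Between² A B C → Between (p A) (p B) (p C) × Between (q A) (q B) (q C)
  Between²⇒rotated A B C le =
    ≤-split (subst₂ ℕ._≤_ (twice-path A B C) (twice-dist A C) (ℕₚ.*-monoʳ-≤ 2 le))
            (abs-triangle (p A) (p B) (p C)) (abs-triangle (q A) (q B) (q C))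

  rotated⇒Between² : ∀ A B C → Between (p A) (p B) (p C) → Between (q A) (q B) (q C) → Between² A B C
  rotated⇒Between² A B C lp lq =
    ℕₚ.*-cancelˡ-≤ 2 (subst₂ ℕ._≤_ (sym (twice-path A B C)) (sym (twice-dist A C)) (ℕₚ.+-mono-≤ lp lq))

  Between²-convex : ∀ A C Z Z' T → Between² A Z C → Between² A Z' C → Between² Z T Z' → Between² A T C
  Between²-convex A C Z Z' T z∈ z'∈ t∈ = rotated⇒Between² A T C
    (Between-convex {p A} {p C} {p Z} {p Z'} {p T} (proj₁ z-rot) (proj₁ z'-rot) (proj₁ t-rot))
    (Between-convex {q A} {q C} {q Z} {q Z'} {q T} (proj₂ z-rot) (proj₂ z'-rot) (proj₂ t-rot))
    where
    z-rot  : Between (p A) (p Z) (p C) × Between (q A) (q Z) (q C)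
    z-rot  = Between²⇒rotated A Z C z∈
    z'-rot : Between (p A) (p Z') (p C) × Between (q A) (q Z') (q C)
    z'-rot = Between²⇒rotated A Z' C z'∈
    t-rot  : Between (p Z) (p T) (p Z') × Between (q Z) (q T) (q Z')
    t-rot  = Between²⇒rotated Z T Z' t∈

  𝟘 : Point
  𝟘 = (0ℤ , 0ℤ)

  ⊕-⊖-cancel : ∀ Z Y → (Z ⊕ Y) ⊖ Z ≡ Y
  ⊕-⊖-cancel (x , y) (x' , y') = cong₂ _,_ (cancel x x') (cancel y y')
    where
    cancel : ∀ a b → (a + b) - a ≡ b
    cancel = solve-∀

  ⊕-⊖-translate : ∀ Z X Y → (Z ⊕ X) ⊖ (Z ⊕ Y) ≡ X ⊖ Y
  ⊕-⊖-translate (x , y) (x' , y') (x'' , y'') = cong₂ _,_ (translate x x' x'') (translate y y' y'')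
    where
    translate : ∀ a b c → (a + b) - (a + c) ≡ b - c
    translate = solve-∀

  ⊕-⊖-inverse : ∀ Z W → Z ⊕ (W ⊖ Z) ≡ W
  ⊕-⊖-inverse (x , y) (x' , y') = cong₂ _,_ (inverse x x') (inverse y y')
    where
    inverse : ∀ a b → a + (b - a) ≡ b
    inverse = solve-∀

  dist-from-𝟘 : ∀ Z → dist 𝟘 Z ≡ ∥ Z ∥
  dist-from-𝟘 (x , y) = cong₂ (λ a b → ∣ a ∣ ℕ.⊔ ∣ b ∣) (ℤₚ.+-identityʳ x) (ℤₚ.+-identityʳ y)

  norm-triangle : ∀ X Y → ∥ X ⊕ Y ∥ ℕ.≤ ∥ X ∥ ℕ.+ ∥ Y ∥
  norm-triangle (x , y) (x' , y') = ℕₚ.⊔-lub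
    (ℕₚ.≤-trans (ℤₚ.∣i+j∣≤∣i∣+∣j∣ x x') (ℕₚ.+-mono-≤ (ℕₚ.m≤m⊔n ∣ x ∣ ∣ y ∣) (ℕₚ.m≤m⊔n ∣ x' ∣ ∣ y' ∣)))
    (ℕₚ.≤-trans (ℤₚ.∣i+j∣≤∣i∣+∣j∣ y y') (ℕₚ.+-mono-≤ (ℕₚ.m≤n⊔m ∣ x ∣ ∣ y ∣) (ℕₚ.m≤n⊔m ∣ x' ∣ ∣ y' ∣)))

  dist-sym : ∀ A B → dist A B ≡ dist B A
  dist-sym (x , y) (x' , y') = cong₂ ℕ._⊔_ (ℤₚ.∣i-j∣≡∣j-i∣ x' x) (ℤₚ.∣i-j∣≡∣j-i∣ y' y)

  dist-triangle : ∀ A B C → dist A C ℕ.≤ dist A B ℕ.+ dist B C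
  dist-triangle (x , y) (x' , y') (x'' , y'') = ℕₚ.⊔-lub
    (ℕₚ.≤-trans (abs-triangle x x' x'') (ℕₚ.+-mono-≤ (ℕₚ.m≤m⊔n ∣ x' - x ∣ ∣ y' - y ∣) (ℕₚ.m≤m⊔n ∣ x'' - x' ∣ ∣ y'' - y' ∣)))
    (ℕₚ.≤-trans (abs-triangle y y' y'') (ℕₚ.+-mono-≤ (ℕₚ.m≤n⊔m ∣ x' - x ∣ ∣ y' - y ∣) (ℕₚ.m≤n⊔m ∣ x'' - x' ∣ ∣ y'' - y' ∣)))

  open MetricWidth dist dist-sym dist-triangle public using (width)

module GraphFacts (G : Graph) where
  open import Data.Nat using (_+_; _≤_)

  walk-nonempty : ∀ {x y vs} → Walk G x y vs → 1 ≤ length vs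
  walk-nonempty here       = s≤s z≤n
  walk-nonempty (step _ _) = s≤s z≤n

  _++ʷ_ : ∀ {x y z vs ws} → Walk G x y vs → Walk G y z (y ∷ ws) → Walk G x z (vs ++ ws)
  here       ++ʷ w' = w'
  step e w   ++ʷ w' = step e (w ++ʷ w')

  split : ∀ {x y t vs} → Walk G x y vs → t ∈ vs →
          ∃[ us ] ∃[ ws ] (Walk G x t us × Walk G t y ws × length us + length ws ≡ suc (length vs))
  split here       (here refl) = _ , _ , here , here , refl
  split (step e w) (here refl) = _ , _ , here , step e w , refl
  split (step e w) (there t∈) with split w t∈
  ... | us , ws , w₁ , w₂ , len = _ , ws , step e w₁ , w₂ , cong suc len

  shortest-path-closed : ∀ (T : V G → Set) → Convex G T → ∀ {x y z vs} → T x → T y → Walk G x y vs →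
                         (∀ ws → Walk G x y ws → length vs ≤ length ws) → z ∈ vs → T z
  shortest-path-closed T convex {x} {y} {z} {vs} Tx Ty w minimal z∈ =
    convex z (x , y , Tx , Ty , inj₂ (inj₂ (vs , (w , minimal) , z∈)))

  distance≥2 : ∀ {x y} → ¬ x ≡ y → ¬ E G x y → ∀ ws → Walk G x y ws → 3 ≤ length ws
  distance≥2 x≢y _    _ here                  = ⊥-elim (x≢y refl)
  distance≥2 _   x≁y  _ (step e here)         = ⊥-elim (x≁y e)
  distance≥2 _   _    _ (step _ (step _ w))   = s≤s (s≤s (walk-nonempty w))

  common-neighbour-closed : ∀ (T : V G → Set) → Convex G T → ∀ {x y z} → T x → T y →
                            ¬ x ≡ y → ¬ E G x y → E G x z → E G z y → T z
  common-neighbour-closed T convex Tx Ty x≢y x≁y e₁ e₂ =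
    shortest-path-closed T convex Tx Ty (step e₁ (step e₂ here)) (distance≥2 x≢y x≁y) (there (here refl))

  module Chain (f : ℕ → V G) (adjacent : ∀ t → E G (f t) (f (suc t))) where
    chain      : ℕ → ℕ → List (V G)
    chain-tail : ℕ → ℕ → List (V G)
    chain s m = f s ∷ chain-tail s m
    chain-tail s zero    = []
    chain-tail s (suc m) = chain (suc s) m

    chain-walk : ∀ s m → Walk G (f s) (f (m + s)) (chain s m)
    chain-walk s zero    = here
    chain-walk s (suc m) =
      step (adjacent s) (subst (λ v → Walk G (f (suc s)) v (chain (suc s) m)) (cong f (ℕₚ.+-suc m s))
                               (chain-walk (suc s) m))

    chain-length : ∀ s m → length (chain s m) ≡ suc m
    chain-length s zero    = refl
    chain-length s (suc m) = cong suc (chain-length (suc s) m)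

    chain-member : ∀ s m t → t ≤ m → f (t + s) ∈ chain s m
    chain-member s m       zero    _         = here refl
    chain-member s (suc m) (suc t) (s≤s t≤m) =
      there (subst (_∈ chain (suc s) m) (cong f (ℕₚ.+-suc t s)) (chain-member (suc s) m t t≤m))

  empty-convex : Convex G (λ _ → ⊥)
  empty-convex _ (_ , _ , () , _)

  singleton-convex : ∀ s → Convex G (_≡ s)
  singleton-convex s z (_ , _ , refl , refl , inj₁ z≡s)        = z≡s
  singleton-convex s z (_ , _ , refl , refl , inj₂ (inj₁ z≡s)) = z≡s
  singleton-convex s z (_ , _ , refl , refl , inj₂ (inj₂ (vs , (w , minimal) , z∈))) =
    trivial-walk vs w (minimal (s ∷ []) here) z∈
    where
    trivial-walk : ∀ vs → Walk G s s vs → length vs ≤ 1 → z ∈ vs → z ≡ s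
    trivial-walk _ here              _       (here z≡s) = z≡s
    trivial-walk _ (step _ w) (s≤s len≤0) _ with ℕₚ.≤-trans (walk-nonempty w) len≤0
    ... | ()

  hull-set-size≥2 : ∀ {x y} → ¬ x ≡ y → ∀ S → IsHullSet G S → 2 ≤ length S
  hull-set-size≥2 {x} _ [] hull = ⊥-elim (hull (λ _ → ⊥) empty-convex (λ _ ()) x)
  hull-set-size≥2 {x} {y} x≢y (s ∷ []) hull =
    ⊥-elim (x≢y (trans (hull (_≡ s) (singleton-convex s) s∈ x) (sym (hull (_≡ s) (singleton-convex s) s∈ y))))
    where
    s∈ : ∀ v → v ∈ (s ∷ []) → v ≡ s
    s∈ v (here v≡s) = v≡s
  hull-set-size≥2 _ (_ ∷ _ ∷ _) _ = s≤s (s≤s z≤n)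

  record ProperConvexSet (u v : V G) : Set₁ where
    field
      members  : V G → Set
      convex   : Convex G members
      has-u    : members u
      has-v    : members v
      outsider : V G
      misses   : ¬ members outsider

  excluded : ∀ {u v} (P : ProperConvexSet u v) {S} → (∀ s → s ∈ S → ProperConvexSet.members P s) → ¬ IsHullSet G S
  excluded P contains hull = misses (hull members convex contains outsider)
    where open ProperConvexSet P

  hull-set-size≥3 : V G → (∀ u v → ProperConvexSet u v) → ∀ S → IsHullSet G S → 3 ≤ length S
  hull-set-size≥3 x proper [] hull = ⊥-elim (excluded (proper x x) (λ _ ()) hull)
  hull-set-size≥3 _ proper (s ∷ []) hull = ⊥-elim (excluded (proper s s) contains hull)
    where
    open ProperConvexSet (proper s s)
    contains : ∀ v → v ∈ (s ∷ []) → members v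
    contains v (here refl) = has-u
  hull-set-size≥3 _ proper (s ∷ s' ∷ []) hull = ⊥-elim (excluded (proper s s') contains hull)
    where
    open ProperConvexSet (proper s s')
    contains : ∀ v → v ∈ (s ∷ s' ∷ []) → members v
    contains v (here refl)         = has-u
    contains v (there (here refl)) = has-v
  hull-set-size≥3 _ _ (_ ∷ _ ∷ _ ∷ _) _ = s≤s (s≤s (s≤s z≤n))

-- Vertices are addressed by natural numbers modulo n = 2h+1;
-- the signed displacement r a b ∈ [-h, h] is the representative of b - a modulo n,
-- so that |r a b| is the distance from a to b.
module OddCycle (h : ℕ) where
  open import Data.Nat.DivMod using (m%n<n; [m+kn]%n≡m%n; [m+n]%n≡m%n; m<n⇒m%n≡m; %-distribˡ-+; m%n%n≡m%n; m%n≤n)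
  open import Data.Integer.DivMod using (_%ℕ_; _/ℕ_; n%ℕd<d; a≡a%ℕn+[a/ℕn]*n)
  open import Data.Fin using (fromℕ<)
  open import Data.Fin.Properties using (toℕ-fromℕ<; toℕ-injective; toℕ<n)

  n : ℕ
  n = suc (2 ℕ.* h)

  Vertex : Set
  Vertex = V (C n)

  Adj : Vertex → Vertex → Set
  Adj = E (C n)

  adj-sym : ∀ {a b} → Adj a b → Adj b a
  adj-sym (inj₁ p) = inj₂ p
  adj-sym (inj₂ p) = inj₁ p

  module _ where
    open import Data.Nat using (_+_; _*_; _%_; _≤_; _∸_)

    abstract
      pos : ℕ → Vertex
      pos i = fromℕ< (m%n<n i n)

      toℕ-pos : ∀ i → toℕ (pos i) ≡ i % n
      toℕ-pos i = toℕ-fromℕ< _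

    pos-toℕ : ∀ a → pos (toℕ a) ≡ a
    pos-toℕ a = toℕ-injective (trans (toℕ-pos (toℕ a)) (m<n⇒m%n≡m (toℕ<n a)))

    pos-periodic : ∀ i k → pos (i + k * n) ≡ pos i
    pos-periodic i k = toℕ-injective (begin
      toℕ (pos (i + k * n))  ≡⟨ toℕ-pos (i + k * n) ⟩
      (i + k * n) % n        ≡⟨ [m+kn]%n≡m%n i k n ⟩
      i % n                  ≡⟨ toℕ-pos i ⟨
      toℕ (pos i)            ∎)
      where open ≡-Reasoning

    pos-around : ∀ i → pos (suc (i + 2 * h)) ≡ pos i
    pos-around i = trans (cong pos (once-around i h)) (pos-periodic i 1)
      where
      once-around : ∀ i h → suc (i + 2 * h) ≡ i + 1 * suc (2 * h)
      once-around = ℕ-solver.solve-∀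

    mod-+ˡ : ∀ a b → (a % n + b) % n ≡ (a + b) % n
    mod-+ˡ a b = begin
      (a % n + b) % n            ≡⟨ %-distribˡ-+ (a % n) b n ⟩
      (a % n % n + b % n) % n    ≡⟨ cong (λ t → (t + b % n) % n) (m%n%n≡m%n a n) ⟩
      (a % n + b % n) % n        ≡⟨ %-distribˡ-+ a b n ⟨
      (a + b) % n                ∎
      where open ≡-Reasoning

    mod-+ʳ : ∀ a b → (a + b % n) % n ≡ (a + b) % n
    mod-+ʳ a b = begin
      (a + b % n) % n   ≡⟨ cong (_% n) (ℕₚ.+-comm a (b % n)) ⟩
      (b % n + a) % n   ≡⟨ mod-+ˡ b a ⟩
      (b + a) % n       ≡⟨ cong (_% n) (ℕₚ.+-comm b a) ⟩
      (a + b) % n       ∎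
      where open ≡-Reasoning

    -- pos i has the neighbours pos (1 + i) and pos (2h + i) = pos (i - 1).
    adjacent-suc : ∀ i → Adj (pos i) (pos (suc i))
    adjacent-suc i = inj₁ (begin
      toℕ (pos (suc i))        ≡⟨ toℕ-pos (suc i) ⟩
      suc i % n                ≡⟨ cong (_% n) (ℕₚ.+-comm 1 i) ⟩
      (i + 1) % n              ≡⟨ mod-+ˡ i 1 ⟨
      (i % n + 1) % n          ≡⟨ cong (λ t → (t + 1) % n) (toℕ-pos i) ⟨
      (toℕ (pos i) + 1) % n    ∎)
      where open ≡-Reasoning

    adjacent-pred : ∀ i → Adj (pos i) (pos (2 * h + i))
    adjacent-pred i = inj₂ (begin
      toℕ (pos i)                      ≡⟨ toℕ-pos i ⟩
      i % n                            ≡⟨ [m+n]%n≡m%n i n ⟨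
      (i + n) % n                      ≡⟨ cong (_% n) (rearrange i h) ⟩
      (2 * h + i + 1) % n              ≡⟨ mod-+ˡ (2 * h + i) 1 ⟨
      ((2 * h + i) % n + 1) % n        ≡⟨ cong (λ t → (t + 1) % n) (toℕ-pos (2 * h + i)) ⟨
      (toℕ (pos (2 * h + i)) + 1) % n  ∎)
      where
      open ≡-Reasoning
      rearrange : ∀ i h → i + suc (2 * h) ≡ 2 * h + i + 1
      rearrange = ℕ-solver.solve-∀

    window : ∀ p a → ∃[ j ] (j ≤ 2 * h × pos (j + p) ≡ a)
    window p a = j , ℕₚ.≤-pred (m%n<n (toℕ a + c) n) , toℕ-injective (begin
      toℕ (pos (j + p))          ≡⟨ toℕ-pos (j + p) ⟩
      (j + p) % n                ≡⟨ mod-+ˡ (toℕ a + c) p ⟩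
      (toℕ a + c + p) % n        ≡⟨ mod-+ʳ (toℕ a + c) p ⟨
      (toℕ a + c + p % n) % n    ≡⟨ cong (_% n) (ℕₚ.+-assoc (toℕ a) c (p % n)) ⟩
      (toℕ a + (c + p % n)) % n  ≡⟨ cong (λ t → (toℕ a + t) % n) (ℕₚ.m∸n+n≡m (m%n≤n p n)) ⟩
      (toℕ a + n) % n            ≡⟨ [m+n]%n≡m%n (toℕ a) n ⟩
      toℕ a % n                  ≡⟨ m<n⇒m%n≡m (toℕ<n a) ⟩
      toℕ a                      ∎)
      where
      open ≡-Reasoning
      c j : ℕ
      c = n ∸ p % n
      j = (toℕ a + c) % n

  module _ where
    open import Data.Integer using (+_; -[1+_]; _+_; _-_; -_; _*_)

    infix 4 _≋_
    record _≋_ (x y : ℤ) : Set where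
      constructor congruent
      field
        quotient : ℤ
        equation : x ≡ y + quotient * + n

    ≋-refl : ∀ {x} → x ≋ x
    ≋-refl {x} = congruent 0ℤ (identity x (+ n))
      where
      identity : ∀ a b → a ≡ a + 0ℤ * b
      identity = solve-∀

    ≡⇒≋ : ∀ {x y} → x ≡ y → x ≋ y
    ≡⇒≋ refl = ≋-refl

    ≋-sym : ∀ {x y} → x ≋ y → y ≋ x
    ≋-sym {x} {y} (congruent m eq) = congruent (- m) (begin
      y                          ≡⟨ identity y m (+ n) ⟩
      (y + m * + n) + - m * + n  ≡⟨ cong (_+ - m * + n) eq ⟨
      x + - m * + n              ∎)
      where
      open ≡-Reasoning
      identity : ∀ a b c → a ≡ (a + b * c) + - b * c
      identity = solve-∀

    ≋-trans : ∀ {x y z} → x ≋ y → y ≋ z → x ≋ z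
    ≋-trans {x} {y} {z} (congruent m eq) (congruent k eq') = congruent (k + m) (begin
      x                          ≡⟨ eq ⟩
      y + m * + n                ≡⟨ cong (_+ m * + n) eq' ⟩
      z + k * + n + m * + n      ≡⟨ identity z k m (+ n) ⟩
      z + (k + m) * + n          ∎)
      where
      open ≡-Reasoning
      identity : ∀ a b c d → a + b * d + c * d ≡ a + (b + c) * d
      identity = solve-∀

    ≋-+ : ∀ {x y x' y'} → x ≋ y → x' ≋ y' → x + x' ≋ y + y'
    ≋-+ {x} {y} {x'} {y'} (congruent m eq) (congruent k eq') = congruent (m + k) (begin
      x + x'                          ≡⟨ cong₂ _+_ eq eq' ⟩
      (y + m * + n) + (y' + k * + n)  ≡⟨ identity y y' m k (+ n) ⟩
      y + y' + (m + k) * + n          ∎)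
      where
      open ≡-Reasoning
      identity : ∀ a b c d e → (a + c * e) + (b + d * e) ≡ a + b + (c + d) * e
      identity = solve-∀

    ≋-neg : ∀ {x y} → x ≋ y → - x ≋ - y
    ≋-neg {x} {y} (congruent m eq) = congruent (- m) (trans (cong -_ eq) (identity y m (+ n)))
      where
      identity : ∀ a b c → - (a + b * c) ≡ - a + - b * c
      identity = solve-∀

    ≋-- : ∀ {x y x' y'} → x ≋ y → x' ≋ y' → x - x' ≋ y - y'
    ≋-- p q = ≋-+ p (≋-neg q)

    %ℕ≋ : ∀ z → + (z %ℕ n) ≋ z
    %ℕ≋ z = ≋-sym (congruent (z /ℕ n) (a≡a%ℕn+[a/ℕn]*n z n))

    toℕ-pos≋ : ∀ i → + toℕ (pos i) ≋ + i
    toℕ-pos≋ i = subst (λ k → + k ≋ + i) (sym (toℕ-pos i)) (%ℕ≋ (+ i))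

    small-multiple : ∀ {e} → e ≋ 0ℤ → ∣ e ∣ ℕ.< n → e ≡ 0ℤ
    small-multiple {e} (congruent m eq) small = by-quotient ∣ m ∣ refl
      where
      ∣e∣≡ : ∣ e ∣ ≡ ∣ m ∣ ℕ.* n
      ∣e∣≡ = trans (cong ∣_∣ (trans eq (ℤₚ.+-identityˡ (m * + n)))) (ℤₚ.abs-* m (+ n))
      by-quotient : ∀ k → ∣ m ∣ ≡ k → e ≡ 0ℤ
      by-quotient zero    ∣m∣≡0 = trans eq (cong (λ k → 0ℤ + k * + n) (ℤₚ.∣i∣≡0⇒i≡0 {m} ∣m∣≡0))
      by-quotient (suc j) ∣m∣≡ = ⊥-elim (ℕₚ.<⇒≱ small
        (subst (n ℕ.≤_) (sym (trans ∣e∣≡ (cong (ℕ._* n) ∣m∣≡))) (ℕₚ.m≤m+n n (j ℕ.* n))))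

    ≋⇒≡ : ∀ {x y} → x ≋ y → ∣ x ∣ ℕ.+ ∣ y ∣ ℕ.< n → x ≡ y
    ≋⇒≡ {x} {y} (congruent m eq) small = ℤₚ.i-j≡0⇒i≡j x y
      (small-multiple (congruent m (trans (cong (_- y) eq) (identity y (m * + n))))
                      (ℕₚ.≤-<-trans (ℤₚ.∣i-j∣≤∣i∣+∣j∣ x y) small))
      where
      identity : ∀ a b → a + b - a ≡ 0ℤ + b
      identity = solve-∀

    ≋⇒≡-within-h : ∀ {x y} → x ≋ y → ∣ x ∣ ℕ.≤ h → ∣ y ∣ ℕ.≤ h → x ≡ y
    ≋⇒≡-within-h {x} {y} eq x≤h y≤h = ≋⇒≡ eq (s≤s (subst (∣ x ∣ ℕ.+ ∣ y ∣ ℕ.≤_)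
      (cong (h ℕ.+_) (sym (ℕₚ.+-identityʳ h))) (ℕₚ.+-mono-≤ x≤h y≤h)))

    abstract
      reduce : ℤ → ℤ
      reduce z = + ((z + + h) %ℕ n) - + h

      reduce≋ : ∀ z → reduce z ≋ z
      reduce≋ z = ≋-trans (≋-- (%ℕ≋ (z + + h)) ≋-refl) (≡⇒≋ (identity z (+ h)))
        where
        identity : ∀ a b → a + b - b ≡ a
        identity = solve-∀

      reduce-bound : ∀ z → ∣ reduce z ∣ ℕ.≤ h
      reduce-bound z = centred _ (ℕₚ.≤-pred (n%ℕd<d (z + + h) n))
        where
        centred : ∀ m → m ℕ.≤ 2 ℕ.* h → ∣ + m - + h ∣ ℕ.≤ h
        centred m m≤2h with ℕₚ.≤-total m h
        ... | inj₁ m≤h = subst (ℕ._≤ h) (sym (trans (cong ∣_∣ (ℤₚ.m-n≡m⊖n m h)) (ℤₚ.∣⊖∣-≤ m≤h)))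
                               (ℕₚ.m∸n≤m h m)
        ... | inj₂ h≤m = subst (ℕ._≤ h)
                               (sym (trans (cong ∣_∣ (ℤₚ.m-n≡m⊖n m h)) (trans (ℤₚ.∣m⊖n∣≡∣n⊖m∣ m h) (ℤₚ.∣⊖∣-≤ h≤m))))
                               (ℕₚ.m≤n+o⇒m∸n≤o m h (subst (m ℕ.≤_) (cong (h ℕ.+_) (ℕₚ.+-identityʳ h)) m≤2h))

      r : Vertex → Vertex → ℤ
      r a b = reduce (+ toℕ b - + toℕ a)

      r-bound : ∀ a b → ∣ r a b ∣ ℕ.≤ h
      r-bound a b = reduce-bound (+ toℕ b - + toℕ a)

      r≋ : ∀ a b → r a b ≋ + toℕ b - + toℕ a
      r≋ a b = reduce≋ (+ toℕ b - + toℕ a)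

    r-trans≋ : ∀ a b c → r a c ≋ r a b + r b c
    r-trans≋ a b c = ≋-trans (r≋ a c) (≋-sym (≋-trans (≋-+ (r≋ a b) (r≋ b c))
                                                     (≡⇒≋ (telescope (+ toℕ a) (+ toℕ b) (+ toℕ c)))))
      where
      telescope : ∀ x y z → (y - x) + (z - y) ≡ z - x
      telescope = solve-∀

    r-sub≋ : ∀ a b c → r b c ≋ r a c - r a b
    r-sub≋ a b c = ≋-sym (≋-trans (≋-- (r-trans≋ a b c) (≋-refl {r a b})) (≡⇒≋ (cancel (r a b) (r b c))))
      where
      cancel : ∀ x y → x + y - x ≡ y
      cancel = solve-∀

    r-additive : ∀ a b c → ∣ r a b + r b c ∣ ℕ.≤ h → r a c ≡ r a b + r b c
    r-additive a b c small = ≋⇒≡-within-h (r-trans≋ a b c) (r-bound a c) small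

    r-difference : ∀ a b c → ∣ r a c - r a b ∣ ℕ.≤ h → r b c ≡ r a c - r a b
    r-difference a b c small = ≋⇒≡-within-h (r-sub≋ a b c) (r-bound b c) small

    r-self : ∀ a → r a a ≡ 0ℤ
    r-self a = ≋⇒≡-within-h (≋-trans (r≋ a a) (≡⇒≋ (ℤₚ.+-inverseʳ (+ toℕ a)))) (r-bound a a) z≤n

    r≡0⇒≡ : ∀ a b → r a b ≡ 0ℤ → a ≡ b
    r≡0⇒≡ a b r≡0 = sym (toℕ-injective (ℤₚ.+-injective (ℤₚ.i-j≡0⇒i≡j (+ toℕ b) (+ toℕ a) difference≡0)))
      where
      difference≡0 : + toℕ b - + toℕ a ≡ 0ℤ
      difference≡0 = small-multiple (≋-trans (≋-sym (r≋ a b)) (≡⇒≋ r≡0))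
        (ℕₚ.≤-<-trans (subst (ℕ._≤ toℕ b ℕ.⊔ toℕ a) (cong ∣_∣ (sym (ℤₚ.m-n≡m⊖n (toℕ b) (toℕ a))))
                                                   (ℤₚ.∣m⊝n∣≤m⊔n (toℕ b) (toℕ a)))
                      (ℕₚ.⊔-pres-<m (toℕ<n b) (toℕ<n a)))

    r-pos : ∀ i j → j ℕ.≤ h → r (pos i) (pos (j ℕ.+ i)) ≡ + j
    r-pos i j j≤h = ≋⇒≡-within-h
      (≋-trans (r≋ (pos i) (pos (j ℕ.+ i)))
               (≋-trans (≋-- (toℕ-pos≋ (j ℕ.+ i)) (toℕ-pos≋ i))
                        (≡⇒≋ (trans (cong (_- + i) (ℤₚ.pos-+ j i)) (cancel (+ j) (+ i))))))
      (r-bound (pos i) (pos (j ℕ.+ i))) j≤h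
      where
      cancel : ∀ x y → x + y - y ≡ x
      cancel = solve-∀

    ∣r-pos∣ : ∀ i j → j ℕ.≤ h → ∣ r (pos i) (pos (j ℕ.+ i)) ∣ ≡ j
    ∣r-pos∣ i j j≤h = cong ∣_∣ (r-pos i j j≤h)

    pos-distinct : ∀ i j → 1 ℕ.≤ j → j ℕ.≤ h → ¬ pos i ≡ pos (j ℕ.+ i)
    pos-distinct i (suc j) _ j≤h same = nonzero (trans (sym (r-pos i (suc j) j≤h))
                                                       (trans (cong (r (pos i)) (sym same)) (r-self (pos i))))
      where
      nonzero : ¬ + suc j ≡ 0ℤ
      nonzero ()

    r-successor : 1 ℕ.≤ h → ∀ a b → toℕ b ≡ (toℕ a ℕ.+ 1) ℕ.% n → r a b ≡ 1ℤ
    r-successor 1≤h a b b≡a+1 = ≋⇒≡-within-h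
      (≋-trans (r≋ a b) (≋-trans (≋-- successor≋ (≋-refl {+ toℕ a})) (≡⇒≋ (cancel (+ toℕ a) 1ℤ))))
      (r-bound a b) 1≤h
      where
      cancel : ∀ x y → x + y - x ≡ y
      cancel = solve-∀
      successor≋ : + toℕ b ≋ + toℕ a + 1ℤ
      successor≋ = subst (λ k → + k ≋ + toℕ a + 1ℤ) (sym b≡a+1)
                         (≋-trans (%ℕ≋ (+ (toℕ a ℕ.+ 1))) (≡⇒≋ (ℤₚ.pos-+ (toℕ a) 1)))

    r-predecessor : 1 ℕ.≤ h → ∀ a b → r b a ≡ 1ℤ → r a b ≡ -1ℤ
    r-predecessor 1≤h a b r-ba≡1 = trans (r-difference b a b small) r-bb-ba
      where
      r-bb-ba : r b b - r b a ≡ -1ℤ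
      r-bb-ba = cong₂ _-_ (r-self b) r-ba≡1
      small : ∣ r b b - r b a ∣ ℕ.≤ h
      small = subst (ℕ._≤ h) (sym (cong ∣_∣ r-bb-ba)) 1≤h

    r-adjacent : 1 ℕ.≤ h → ∀ a b → Adj a b → (r a b ≡ 1ℤ) ⊎ (r a b ≡ -1ℤ)
    r-adjacent 1≤h a b (inj₁ b≡a+1) = inj₁ (r-successor 1≤h a b b≡a+1)
    r-adjacent 1≤h a b (inj₂ a≡b+1) = inj₂ (r-predecessor 1≤h a b (r-successor 1≤h b a a≡b+1))

    two-apart-distinct : 2 ℕ.≤ h → ∀ i → ¬ pos i ≡ pos (2 ℕ.+ i)
    two-apart-distinct 2≤h i = pos-distinct i 2 (s≤s z≤n) 2≤h

    two-apart-non-adjacent : 2 ℕ.≤ h → ∀ i → ¬ Adj (pos i) (pos (2 ℕ.+ i))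
    two-apart-non-adjacent 2≤h i adj with r-adjacent (ℕₚ.≤-trans (s≤s z≤n) 2≤h) (pos i) (pos (2 ℕ.+ i)) adj
    ... | inj₁ r≡1  = 2≢1 (trans (sym (r-pos i 2 2≤h)) r≡1)
      where
      2≢1 : ¬ + 2 ≡ 1ℤ
      2≢1 ()
    ... | inj₂ r≡-1 = 2≢-1 (trans (sym (r-pos i 2 2≤h)) r≡-1)
      where
      2≢-1 : ¬ + 2 ≡ -1ℤ
      2≢-1 ()

    r-triangle : ∀ a b c → ∣ r a c ∣ ℕ.≤ ∣ r a b ∣ ℕ.+ ∣ r b c ∣
    r-triangle a b c with ∣ r a b + r b c ∣ ℕ.≤? h
    ... | yes small = ℕₚ.≤-trans (ℕₚ.≤-reflexive (cong ∣_∣ (r-additive a b c small)))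
                                 (ℤₚ.∣i+j∣≤∣i∣+∣j∣ (r a b) (r b c))
    ... | no  large = ℕₚ.≤-trans (r-bound a c)
                                 (ℕₚ.≤-trans (ℕₚ.<⇒≤ (ℕₚ.≰⇒> large)) (ℤₚ.∣i+j∣≤∣i∣+∣j∣ (r a b) (r b c)))

    r-neighbour : 1 ℕ.≤ h → ∀ a a' c → (a ≡ a' ⊎ Adj a a') → ∣ r a c ∣ ℕ.≤ suc ∣ r a' c ∣
    r-neighbour 1≤h a a' c near = ℕₚ.≤-trans (r-triangle a a' c) (ℕₚ.+-monoˡ-≤ ∣ r a' c ∣ (one-step near))
      where
      one-step : a ≡ a' ⊎ Adj a a' → ∣ r a a' ∣ ℕ.≤ 1
      one-step (inj₁ refl) = subst (ℕ._≤ 1) (sym (cong ∣_∣ (r-self a))) z≤n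
      one-step (inj₂ adj) with r-adjacent 1≤h a a' adj
      ... | inj₁ r≡1  = ℕₚ.≤-reflexive (cong ∣_∣ r≡1)
      ... | inj₂ r≡-1 = ℕₚ.≤-reflexive (cong ∣_∣ r≡-1)

    successor predecessor : Vertex → Vertex
    successor a   = pos (suc (toℕ a))
    predecessor a = pos (2 ℕ.* h ℕ.+ toℕ a)

    adj-successor : ∀ a → Adj a (successor a)
    adj-successor a = subst (λ b → Adj b (successor a)) (pos-toℕ a) (adjacent-suc (toℕ a))

    adj-predecessor : ∀ a → Adj a (predecessor a)
    adj-predecessor a = subst (λ b → Adj b (predecessor a)) (pos-toℕ a) (adjacent-pred (toℕ a))

    r-to-successor : 1 ℕ.≤ h → ∀ a → r a (successor a) ≡ 1ℤ
    r-to-successor 1≤h a = subst (λ b → r b (successor a) ≡ 1ℤ) (pos-toℕ a) (r-pos (toℕ a) 1 1≤h)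

    r-to-predecessor : 1 ℕ.≤ h → ∀ a → r a (predecessor a) ≡ -1ℤ
    r-to-predecessor 1≤h a = r-predecessor 1≤h a (predecessor a)
      (subst (λ b → r (predecessor a) b ≡ 1ℤ) around (r-pos (2 ℕ.* h ℕ.+ toℕ a) 1 1≤h))
      where
      around : pos (1 ℕ.+ (2 ℕ.* h ℕ.+ toℕ a)) ≡ a
      around = trans (cong (λ i → pos (suc i)) (ℕₚ.+-comm (2 ℕ.* h) (toℕ a))) (trans (pos-around (toℕ a)) (pos-toℕ a))

    r-from-successor : 1 ℕ.≤ h → ∀ a c j → r a c ≡ + suc j → r (successor a) c ≡ + j
    r-from-successor 1≤h a c j r≡ = trans (r-difference a (successor a) c small) difference
      where
      difference : r a c - r a (successor a) ≡ + j
      difference = cong₂ _-_ r≡ (r-to-successor 1≤h a)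
      small : ∣ r a c - r a (successor a) ∣ ℕ.≤ h
      small = subst (ℕ._≤ h) (sym (cong ∣_∣ difference))
                    (ℕₚ.≤-trans (ℕₚ.n≤1+n j) (subst (ℕ._≤ h) (cong ∣_∣ r≡) (r-bound a c)))

    r-from-predecessor : 1 ℕ.≤ h → ∀ a c j → r a c ≡ -[1+ j ] → r (predecessor a) c ≡ - + j
    r-from-predecessor 1≤h a c j r≡ = trans (r-difference a (predecessor a) c small) difference
      where
      one-closer : ∀ j → -[1+ j ] - -1ℤ ≡ - + j
      one-closer zero    = refl
      one-closer (suc j) = refl
      difference : r a c - r a (predecessor a) ≡ - + j
      difference = trans (cong₂ _-_ r≡ (r-to-predecessor 1≤h a)) (one-closer j)
      small : ∣ r a c - r a (predecessor a) ∣ ℕ.≤ h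
      small = subst (ℕ._≤ h) (sym (trans (cong ∣_∣ difference) (ℤₚ.∣-i∣≡∣i∣ (+ j))))
                    (ℕₚ.≤-trans (ℕₚ.n≤1+n j) (subst (ℕ._≤ h) (cong ∣_∣ r≡) (r-bound a c)))

    -- The first vertex on a shortest path from a to c: a step in the direction of
    -- the sign of r a c.
    step-by-sign : Vertex → ℤ → Vertex
    step-by-sign a (+ zero)  = a
    step-by-sign a (+ suc _) = successor a
    step-by-sign a -[1+ _ ]  = predecessor a

    toward : Vertex → Vertex → Vertex
    toward a c = step-by-sign a (r a c)

    toward-spec : 1 ℕ.≤ h → ∀ a c → (r a c ≡ 0ℤ × toward a c ≡ a)
                                   ⊎ (Adj a (toward a c) × suc ∣ r (toward a c) c ∣ ≡ ∣ r a c ∣)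
    toward-spec 1≤h a c = by-sign (r a c) refl
      where
      by-sign : ∀ z → r a c ≡ z → (r a c ≡ 0ℤ × step-by-sign a z ≡ a)
                                 ⊎ (Adj a (step-by-sign a z) × suc ∣ r (step-by-sign a z) c ∣ ≡ ∣ r a c ∣)
      by-sign (+ zero)  r≡0 = inj₁ (r≡0 , refl)
      by-sign (+ suc j) r≡  = inj₂ (adj-successor a ,
        trans (cong (λ x → suc ∣ x ∣) (r-from-successor 1≤h a c j r≡)) (cong ∣_∣ (sym r≡)))
      by-sign -[1+ j ]  r≡  = inj₂ (adj-predecessor a ,
        trans (cong (λ x → suc ∣ x ∣) (r-from-predecessor 1≤h a c j r≡))
              (trans (cong suc (ℤₚ.∣-i∣≡∣i∣ (+ j))) (cong ∣_∣ (sym r≡))))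

module Torus (h₁ h₂ : ℕ) (1≤h₁ : 1 ℕ.≤ h₁) (1≤h₂ : 1 ℕ.≤ h₂) where
  open import Data.Nat using (_+_; _≤_; _⊔_)
  open ChebyshevPlane using (Point; ∥_∥)
  module C₁ = OddCycle h₁
  module C₂ = OddCycle h₂

  G : Graph
  G = C (suc (2 ℕ.* h₁)) ⊠ C (suc (2 ℕ.* h₂))

  open GraphFacts G

  δ : V G → V G → Point
  δ (a , b) (a' , b') = (C₁.r a a' , C₂.r b b')

  d : V G → V G → ℕ
  d P Q = ∥ δ P Q ∥

  d-self : ∀ P → d P P ≡ 0
  d-self (a , b) = cong₂ (λ x y → ∣ x ∣ ⊔ ∣ y ∣) (C₁.r-self a) (C₂.r-self b)

  d≡0⇒≡ : ∀ P Q → d P Q ≡ 0 → P ≡ Q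
  d≡0⇒≡ (a , b) (c , e) d≡0 = cong₂ _,_
    (C₁.r≡0⇒≡ a c (ℤₚ.∣i∣≡0⇒i≡0 (ℕₚ.n≤0⇒n≡0 (subst (∣ C₁.r a c ∣ ≤_) d≡0 (ℕₚ.m≤m⊔n _ _)))))
    (C₂.r≡0⇒≡ b e (ℤₚ.∣i∣≡0⇒i≡0 (ℕₚ.n≤0⇒n≡0 (subst (∣ C₂.r b e ∣ ≤_) d≡0 (ℕₚ.m≤n⊔m _ _)))))

  d-edge : ∀ {P P' Q} → E G P P' → d P Q ≤ suc (d P' Q)
  d-edge {a , b} {a' , b'} {c , e} (inj₁ (a≡a' , b~b')) =
    ℕₚ.⊔-mono-≤ (C₁.r-neighbour 1≤h₁ a a' c (inj₁ a≡a')) (C₂.r-neighbour 1≤h₂ b b' e (inj₂ b~b'))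
  d-edge {a , b} {a' , b'} {c , e} (inj₂ (inj₁ (b≡b' , a~a'))) =
    ℕₚ.⊔-mono-≤ (C₁.r-neighbour 1≤h₁ a a' c (inj₂ a~a')) (C₂.r-neighbour 1≤h₂ b b' e (inj₁ b≡b'))
  d-edge {a , b} {a' , b'} {c , e} (inj₂ (inj₂ (a~a' , b~b'))) =
    ℕₚ.⊔-mono-≤ (C₁.r-neighbour 1≤h₁ a a' c (inj₂ a~a')) (C₂.r-neighbour 1≤h₂ b b' e (inj₂ b~b'))

  walk-length≥ : ∀ {P Q vs} → Walk G P Q vs → suc (d P Q) ≤ length vs
  walk-length≥ {P} here     = subst (λ k → suc k ≤ 1) (sym (d-self P)) ℕₚ.≤-refl
  walk-length≥ (step e w)   = s≤s (ℕₚ.≤-trans (d-edge e) (walk-length≥ w))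

  approach : V G → V G → V G
  approach (a , b) (c , e) = (C₁.toward a c , C₂.toward b e)

  approach-spec : ∀ P Q m → d P Q ≡ suc m → E G P (approach P Q) × d (approach P Q) Q ≡ m
  approach-spec (a , b) (c , e) m d≡ with C₁.toward-spec 1≤h₁ a c | C₂.toward-spec 1≤h₂ b e
  ... | inj₁ (r₁≡0 , stay₁) | inj₁ (r₂≡0 , stay₂) =
    ⊥-elim (ℕₚ.0≢1+n (trans (sym (cong₂ (λ x y → ∣ x ∣ ⊔ ∣ y ∣) r₁≡0 r₂≡0)) d≡))
  ... | inj₁ (r₁≡0 , stay₁) | inj₂ (adj₂ , closer₂) =
    inj₁ (sym stay₁ , adj₂) ,
    ℕₚ.suc-injective (begin
      suc (∣ C₁.r (C₁.toward a c) c ∣ ⊔ ∣ C₂.r (C₂.toward b e) e ∣) ≡⟨ cong (λ a' → suc (∣ C₁.r a' c ∣ ⊔ _)) stay₁ ⟩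
      suc (∣ C₁.r a c ∣ ⊔ ∣ C₂.r (C₂.toward b e) e ∣)               ≡⟨ cong (λ x → suc (∣ x ∣ ⊔ _)) r₁≡0 ⟩
      suc ∣ C₂.r (C₂.toward b e) e ∣                                ≡⟨ closer₂ ⟩
      ∣ C₂.r b e ∣                                                  ≡⟨ cong (λ x → ∣ x ∣ ⊔ ∣ C₂.r b e ∣) r₁≡0 ⟨
      ∣ C₁.r a c ∣ ⊔ ∣ C₂.r b e ∣                                   ≡⟨ d≡ ⟩
      suc m                                                         ∎)
    where open ≡-Reasoning
  ... | inj₂ (adj₁ , closer₁) | inj₁ (r₂≡0 , stay₂) =
    inj₂ (inj₁ (sym stay₂ , adj₁)) ,
    ℕₚ.suc-injective (begin
      suc (∣ C₁.r (C₁.toward a c) c ∣ ⊔ ∣ C₂.r (C₂.toward b e) e ∣) ≡⟨ cong (λ b' → suc (_ ⊔ ∣ C₂.r b' e ∣)) stay₂ ⟩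
      suc (∣ C₁.r (C₁.toward a c) c ∣ ⊔ ∣ C₂.r b e ∣)               ≡⟨ cong (λ y → suc (_ ⊔ ∣ y ∣)) r₂≡0 ⟩
      suc (∣ C₁.r (C₁.toward a c) c ∣ ⊔ 0)                          ≡⟨ cong suc (ℕₚ.⊔-identityʳ _) ⟩
      suc ∣ C₁.r (C₁.toward a c) c ∣                                ≡⟨ closer₁ ⟩
      ∣ C₁.r a c ∣                                                  ≡⟨ ℕₚ.⊔-identityʳ _ ⟨
      ∣ C₁.r a c ∣ ⊔ 0                                              ≡⟨ cong (λ y → ∣ C₁.r a c ∣ ⊔ ∣ y ∣) r₂≡0 ⟨
      ∣ C₁.r a c ∣ ⊔ ∣ C₂.r b e ∣                                   ≡⟨ d≡ ⟩
      suc m                                                         ∎)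
    where open ≡-Reasoning
  ... | inj₂ (adj₁ , closer₁) | inj₂ (adj₂ , closer₂) =
    inj₂ (inj₂ (adj₁ , adj₂)) , ℕₚ.suc-injective (trans (cong₂ _⊔_ closer₁ closer₂) d≡)

  geodesic : ∀ m P Q → d P Q ≡ m → ∃[ ws ] (Walk G P Q ws × length ws ≡ suc m)
  geodesic zero    P Q d≡0 = P ∷ [] , subst (λ R → Walk G P R (P ∷ [])) (d≡0⇒≡ P Q d≡0) here , refl
  geodesic (suc m) P Q d≡  with approach-spec P Q m d≡
  ... | edge , d'≡ with geodesic m (approach P Q) Q d'≡
  ... | ws , walk , len = P ∷ ws , step edge walk , cong suc len

  interval⇒between : ∀ {P Q t} → Interval G P Q t → d P t + d t Q ≤ d P Q
  interval⇒between {P} {Q} (inj₁ refl)        = ℕₚ.≤-reflexive (cong (_+ d P Q) (d-self P))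
  interval⇒between {P} {Q} (inj₂ (inj₁ refl)) =
    ℕₚ.≤-reflexive (trans (cong (λ k → d P Q + k) (d-self Q)) (ℕₚ.+-identityʳ _))
  interval⇒between {P} {Q} {t} (inj₂ (inj₂ (vs , (walk , minimal) , t∈))) with geodesic (d P Q) P Q refl | split walk t∈
  ... | ws , geo , geo-len | us , us' , to-t , from-t , split-len = ℕₚ.≤-pred (ℕₚ.≤-pred (begin
      suc (suc (d P t + d t Q))       ≡⟨ cong suc (ℕₚ.+-suc (d P t) (d t Q)) ⟨
      suc (d P t) + suc (d t Q)       ≤⟨ ℕₚ.+-mono-≤ (walk-length≥ to-t) (walk-length≥ from-t) ⟩
      length us + length us'          ≡⟨ split-len ⟩
      suc (length vs)                 ≤⟨ s≤s (minimal ws geo) ⟩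
      suc (length ws)                 ≡⟨ cong suc geo-len ⟩
      suc (suc (d P Q))               ∎))
    where open ℕₚ.≤-Reasoning

module TorusConvexSets (h₁ h₂ : ℕ) (1≤h₁ : 1 ℕ.≤ h₁) (1≤h₂ : 1 ℕ.≤ h₂) where
  open import Data.Nat using (_+_; _*_; _≤_)
  open Torus h₁ h₂ 1≤h₁ 1≤h₂
  open GraphFacts G

  X : ℕ → C₁.Vertex
  X = C₁.pos

  Y : ℕ → C₂.Vertex
  Y = C₂.pos

  diagonal-edge : ∀ i j → E G (X i , Y j) (X (suc i) , Y (suc j))
  diagonal-edge i j = inj₂ (inj₂ (C₁.adjacent-suc i , C₂.adjacent-suc j))

  antidiagonal-edge : ∀ i j → E G (X i , Y (suc j)) (X (suc i) , Y j)
  antidiagonal-edge i j = inj₂ (inj₂ (C₁.adjacent-suc i , C₂.adj-sym (C₂.adjacent-suc j)))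

  horizontal-edge : ∀ i y → E G (X i , y) (X (suc i) , y)
  horizontal-edge i y = inj₂ (inj₁ (refl , C₁.adjacent-suc i))

  vertical-edge : ∀ x j → E G (x , Y j) (x , Y (suc j))
  vertical-edge x j = inj₁ (refl , C₂.adjacent-suc j)

  edge-sym : ∀ {P Q} → E G P Q → E G Q P
  edge-sym (inj₁ (refl , b~b'))        = inj₁ (refl , C₂.adj-sym b~b')
  edge-sym (inj₂ (inj₁ (refl , a~a'))) = inj₂ (inj₁ (refl , C₁.adj-sym a~a'))
  edge-sym (inj₂ (inj₂ (a~a' , b~b'))) = inj₂ (inj₂ (C₁.adj-sym a~a' , C₂.adj-sym b~b'))

  module _ (T : V G → Set) (convex : Convex G T) where

    -- Vertices two columns apart are neither equal nor adjacent (h₁ ≥ 2), so each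
    -- common neighbour of two members of T in such position is a member of T.
    column-midpoint : 2 ≤ h₁ → ∀ {i y y' y''} → T (X i , y) → T (X (2 + i) , y') →
                      E G (X i , y) (X (suc i) , y'') → E G (X (suc i) , y'') (X (2 + i) , y') → T (X (suc i) , y'')
    column-midpoint 2≤h₁ {i} Tx Ty = common-neighbour-closed T convex Tx Ty
      (λ eq → C₁.two-apart-distinct 2≤h₁ i (cong proj₁ eq)) non-adjacent
      where
      non-adjacent : ∀ {y y'} → ¬ E G (X i , y) (X (2 + i) , y')
      non-adjacent (inj₁ (eq , _))        = C₁.two-apart-distinct 2≤h₁ i eq
      non-adjacent (inj₂ (inj₁ (_ , adj))) = C₁.two-apart-non-adjacent 2≤h₁ i adj
      non-adjacent (inj₂ (inj₂ (adj , _))) = C₁.two-apart-non-adjacent 2≤h₁ i adj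

    row-midpoint : 2 ≤ h₂ → ∀ {j x x' x''} → T (x , Y j) → T (x' , Y (2 + j)) →
                   E G (x , Y j) (x'' , Y (suc j)) → E G (x'' , Y (suc j)) (x' , Y (2 + j)) → T (x'' , Y (suc j))
    row-midpoint 2≤h₂ {j} Tx Ty = common-neighbour-closed T convex Tx Ty
      (λ eq → C₂.two-apart-distinct 2≤h₂ j (cong proj₂ eq)) non-adjacent
      where
      non-adjacent : ∀ {x x'} → ¬ E G (x , Y j) (x' , Y (2 + j))
      non-adjacent (inj₁ (_ , adj))        = C₂.two-apart-non-adjacent 2≤h₂ j adj
      non-adjacent (inj₂ (inj₁ (eq , _))) = C₂.two-apart-distinct 2≤h₂ j eq
      non-adjacent (inj₂ (inj₂ (_ , adj))) = C₂.two-apart-non-adjacent 2≤h₂ j adj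

    -- A vertical segment of length at most h₂ is a shortest path, so it lies in T
    -- as soon as its end points do.
    vertical-segment : ∀ x i j → j ≤ h₂ → T (x , Y i) → T (x , Y (j + i)) → ∀ t → t ≤ j → T (x , Y (t + i))
    vertical-segment x i j j≤h₂ T-start T-end t t≤j =
      shortest-path-closed T convex T-start T-end (chain-walk i j) minimal (chain-member i j t t≤j)
      where
      open Chain (λ t → (x , Y t)) (vertical-edge x)
      minimal : ∀ ws → Walk G (x , Y i) (x , Y (j + i)) ws → length (chain i j) ≤ length ws
      minimal ws walk = ℕₚ.≤-trans (ℕₚ.≤-reflexive (chain-length i j)) (ℕₚ.≤-trans (s≤s far) (walk-length≥ walk))
        where
        far : j ≤ d (x , Y i) (x , Y (j + i))
        far = ℕₚ.≤-trans (ℕₚ.≤-reflexive (sym (C₂.∣r-pos∣ i j j≤h₂))) (ℕₚ.m≤n⊔m _ _)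

    -- A row contained in T spreads to the next row: (x , Y (1 + j)) is the common
    -- neighbour of (x - 1 , Y j) and (x + 1 , Y j).  Hence T is everything.
    row-spreads : 2 ≤ h₁ → ∀ j → (∀ x → T (x , Y j)) → ∀ x → T (x , Y (suc j))
    row-spreads 2≤h₁ j row x = subst (λ u → T (u , Y (suc j))) (one-after-predecessor x)
      (column-midpoint 2≤h₁ (row (X i)) (row (X (2 + i))) (diagonal-edge i j) (antidiagonal-edge (suc i) j))
      where
      i : ℕ
      i = toℕ x + 2 * h₁
      one-after-predecessor : ∀ x → X (suc (toℕ x + 2 * h₁)) ≡ x
      one-after-predecessor x = trans (C₁.pos-around (toℕ x)) (C₁.pos-toℕ x)

    full-row : 2 ≤ h₁ → ∀ j → (∀ x → T (x , Y j)) → ∀ P → T P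
    full-row 2≤h₁ j row (x , y) with C₂.window j y
    ... | m , _ , Y≡y = subst (λ w → T (x , w)) Y≡y (rows m x)
      where
      rows : ∀ m x → T (x , Y (m + j))
      rows zero    = row
      rows (suc m) = row-spreads 2≤h₁ (m + j) (rows m)

    column-spreads : 2 ≤ h₂ → ∀ i → (∀ y → T (X i , y)) → ∀ y → T (X (suc i) , y)
    column-spreads 2≤h₂ i column y = subst (λ w → T (X (suc i) , w)) (one-after-predecessor y)
      (row-midpoint 2≤h₂ (column (Y j)) (column (Y (2 + j))) (diagonal-edge i j) (edge-sym (antidiagonal-edge i (suc j))))
      where
      j : ℕ
      j = toℕ y + 2 * h₂
      one-after-predecessor : ∀ y → Y (suc (toℕ y + 2 * h₂)) ≡ y
      one-after-predecessor y = trans (C₂.pos-around (toℕ y)) (C₂.pos-toℕ y)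

    full-column : 2 ≤ h₂ → ∀ i → (∀ y → T (X i , y)) → ∀ P → T P
    full-column 2≤h₂ i column (x , y) with C₁.window i x
    ... | m , _ , X≡x = subst (λ u → T (u , y)) X≡x (columns m y)
      where
      columns : ∀ m y → T (X (m + i) , y)
      columns zero    = column
      columns (suc m) = column-spreads 2≤h₂ (m + i) (columns m)

-- In C (2h+1) ⊠ C (2h+1) the metric interval {t | d u t + d t v ≤ d u v} is a
-- proper convex set containing u and v.  Since all distances are at most h, the
-- displacements of points of such an interval can be lifted consistently to the
-- Chebyshev plane ℤ², where metric intervals are convex.
module SquareTorusIntervals (h : ℕ) (1≤h : 1 ℕ.≤ h) where
  import Data.Fin.Properties as Finₚ
  import Data.Product.Properties as Productₚ
  open import Data.Nat using (_+_; _≤_; _⊔_)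
  open Torus h h 1≤h 1≤h
  open ChebyshevPlane
  open GraphFacts G using (ProperConvexSet)

  d-bound : ∀ P Q → d P Q ≤ h
  d-bound (a , b) (c , e) = ℕₚ.⊔-lub (C₁.r-bound a c) (C₂.r-bound b e)

  Between : V G → V G → V G → Set
  Between u t v = d u t + d t v ≤ d u v

  δ-additive : ∀ P Q R → ∥ δ P Q ⊕ δ Q R ∥ ≤ h → δ P R ≡ δ P Q ⊕ δ Q R
  δ-additive (a , b) (a' , b') (a'' , b'') small = cong₂ _,_
    (C₁.r-additive a a' a'' (ℕₚ.≤-trans (ℕₚ.m≤m⊔n _ _) small))
    (C₂.r-additive b b' b'' (ℕₚ.≤-trans (ℕₚ.m≤n⊔m _ _) small))

  δ-difference : ∀ P Q R → ∥ δ P R ⊖ δ P Q ∥ ≤ h → δ Q R ≡ δ P R ⊖ δ P Q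
  δ-difference (a , b) (a' , b') (a'' , b'') small = cong₂ _,_
    (C₁.r-difference a a' a'' (ℕₚ.≤-trans (ℕₚ.m≤m⊔n _ _) small))
    (C₂.r-difference b b' b'' (ℕₚ.≤-trans (ℕₚ.m≤n⊔m _ _) small))

  between-exact : ∀ P Q R → Between P Q R → δ P R ≡ δ P Q ⊕ δ Q R
  between-exact P Q R between =
    δ-additive P Q R (ℕₚ.≤-trans (norm-triangle (δ P Q) (δ Q R)) (ℕₚ.≤-trans between (d-bound P R)))

  last-leg : ∀ P Q R → Between P Q R → ∥ δ P R ⊖ δ P Q ∥ ≡ d Q R
  last-leg P Q R between =
    cong ∥_∥ (trans (cong (_⊖ δ P Q) (between-exact P Q R between)) (⊕-⊖-cancel (δ P Q) (δ Q R)))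

  lift-at-𝟘 : ∀ P Q R → Between P Q R → Between² 𝟘 (δ P Q) (δ P R)
  lift-at-𝟘 P Q R between =
    subst₂ _≤_ (cong₂ _+_ (sym (dist-from-𝟘 (δ P Q))) (sym (last-leg P Q R between)))
               (sym (dist-from-𝟘 (δ P R))) between

  lift-at : ∀ Z P Q R → Between P Q R → Between² Z (Z ⊕ δ P Q) (Z ⊕ δ P R)
  lift-at Z P Q R between =
    subst₂ _≤_ (cong₂ _+_ (sym (dist-lift (δ P Q)))
                          (sym (trans (cong ∥_∥ (⊕-⊖-translate Z (δ P R) (δ P Q))) (last-leg P Q R between))))
               (sym (dist-lift (δ P R))) between
    where
    dist-lift : ∀ X → dist Z (Z ⊕ X) ≡ ∥ X ∥
    dist-lift X = cong ∥_∥ (⊕-⊖-cancel Z X)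

  between-convex : ∀ u v z₁ z₂ t → Between u z₁ v → Between u z₂ v → Between z₁ t z₂ → Between u t v
  between-convex u v z₁ z₂ t z₁∈ z₂∈ t∈ = subst₂ _≤_ (cong₂ _+_ d-ut d-tv) (dist-from-𝟘 Zᵥ) t-between
    where
    Zᵥ Z₁ Z₂ T : Point
    Zᵥ = δ u v
    Z₁ = δ u z₁
    Z₂ = δ u z₂
    T  = Z₁ ⊕ δ z₁ t
    d-uv≤h : dist 𝟘 Zᵥ ≤ h
    d-uv≤h = subst (_≤ h) (sym (dist-from-𝟘 Zᵥ)) (d-bound u v)
    -- the lifts of z₁ and z₂ are close, so the displacement from z₁ to z₂ lifts exactly
    Z₂≡ : Z₁ ⊕ δ z₁ z₂ ≡ Z₂
    Z₂≡ = trans (cong (Z₁ ⊕_) (δ-difference u z₁ z₂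
                  (ℕₚ.≤-trans (width {𝟘} {Zᵥ} {Z₁} {Z₂} (lift-at-𝟘 u z₁ v z₁∈) (lift-at-𝟘 u z₂ v z₂∈)) d-uv≤h)))
                (⊕-⊖-inverse Z₁ Z₂)
    t-between : Between² 𝟘 T Zᵥ
    t-between = Between²-convex 𝟘 Zᵥ Z₁ Z₂ T (lift-at-𝟘 u z₁ v z₁∈) (lift-at-𝟘 u z₂ v z₂∈)
                  (subst (Between² Z₁ T) Z₂≡ (lift-at Z₁ z₁ t z₂ t∈))
    δ-ut : δ u t ≡ T
    δ-ut = δ-additive u z₁ t (subst (_≤ h) (dist-from-𝟘 T)
             (ℕₚ.≤-trans (ℕₚ.m≤m+n (dist 𝟘 T) (dist T Zᵥ)) (ℕₚ.≤-trans t-between d-uv≤h)))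
    d-ut : dist 𝟘 T ≡ d u t
    d-ut = trans (dist-from-𝟘 T) (cong ∥_∥ (sym δ-ut))
    d-tv : dist T Zᵥ ≡ d t v
    d-tv = cong ∥_∥ (sym (trans (δ-difference u t v (subst (λ X → ∥ Zᵥ ⊖ X ∥ ≤ h) (sym δ-ut)
                                  (ℕₚ.≤-trans (ℕₚ.m≤n+m (dist T Zᵥ) (dist 𝟘 T)) (ℕₚ.≤-trans t-between d-uv≤h))))
                             (cong (Zᵥ ⊖_) δ-ut)))

  interval-convex : ∀ u v → Convex G (λ t → Between u t v)
  interval-convex u v t (z₁ , z₂ , z₁∈ , z₂∈ , t∈I) = between-convex u v z₁ z₂ t z₁∈ z₂∈ (interval⇒between t∈I)

  opposite : C₁.Vertex → C₁.Vertex
  opposite a = C₁.pos (h + toℕ a)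

  ∣r-opposite∣ : ∀ a → ∣ C₁.r a (opposite a) ∣ ≡ h
  ∣r-opposite∣ a = subst (λ x → ∣ C₁.r x (opposite a) ∣ ≡ h) (C₁.pos-toℕ a) (C₁.∣r-pos∣ (toℕ a) h ℕₚ.≤-refl)

  opposite-distinct : ∀ a → ¬ opposite a ≡ a
  opposite-distinct a eq = C₁.pos-distinct (toℕ a) h 1≤h ℕₚ.≤-refl (trans (C₁.pos-toℕ a) (sym eq))

  far-vertex : ∀ u v → ∃[ w ] (h ≤ d u w × ¬ w ≡ v)
  far-vertex (a , b) v with Productₚ.≡-dec Finₚ._≟_ Finₚ._≟_ (opposite a , b) v
  ... | no w₁≢v  = (opposite a , b) , far₁ , w₁≢v
    where
    far₁ : h ≤ ∣ C₁.r a (opposite a) ∣ ⊔ ∣ C₂.r b b ∣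
    far₁ = ℕₚ.≤-trans (ℕₚ.≤-reflexive (sym (∣r-opposite∣ a))) (ℕₚ.m≤m⊔n _ _)
  ... | yes w₁≡v = (a , opposite b) , far₂ , λ w₂≡v → opposite-distinct a (cong proj₁ (trans w₁≡v (sym w₂≡v)))
    where
    far₂ : h ≤ ∣ C₁.r a a ∣ ⊔ ∣ C₂.r b (opposite b) ∣
    far₂ = ℕₚ.≤-trans (ℕₚ.≤-reflexive (sym (∣r-opposite∣ b))) (ℕₚ.m≤n⊔m _ _)

  -- The metric interval from u to v is a proper convex set: it misses the far vertex,
  -- since d u w + d w v ≥ h + 1 > d u v.
  interval-proper : ∀ u v → ProperConvexSet u v
  interval-proper u v = record
    { members  = λ t → Between u t v
    ; convex   = interval-convex u v
    ; has-u    = ℕₚ.≤-reflexive (cong (_+ d u v) (d-self u))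
    ; has-v    = ℕₚ.≤-reflexive (trans (cong (λ k → d u v + k) (d-self v)) (ℕₚ.+-identityʳ (d u v)))
    ; outsider = proj₁ (far-vertex u v)
    ; misses   = outside (proj₂ (far-vertex u v))
    }
    where
    outside : ∀ {w} → h ≤ d u w × ¬ w ≡ v → ¬ Between u w v
    outside {w} (far , w≢v) between = ℕₚ.<-irrefl refl (begin-strict
      h               ≡⟨ ℕₚ.+-identityʳ h ⟨
      h + 0           <⟨ ℕₚ.+-monoʳ-< h (ℕₚ.n≢0⇒n>0 (λ d≡0 → w≢v (d≡0⇒≡ w v d≡0))) ⟩
      h + d w v       ≤⟨ ℕₚ.+-monoˡ-≤ (d w v) far ⟩
      d u w + d w v   ≤⟨ between ⟩
      d u v           ≤⟨ d-bound u v ⟩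
      h               ∎)
      where open ℕₚ.≤-Reasoning

-- Both vertical arcs A'B and BA of the cycle through them have length h, so they are
-- shortest paths; thus every convex set containing A, A', B contains the column
-- through them, and then everything.
module ThreeVertexHull (h : ℕ) (2≤h : 2 ℕ.≤ h) where
  open import Data.List.Relation.Unary.All using ([]; _∷_)
  open import Data.List.Relation.Unary.AllPairs using ([]; _∷_)
  open import Data.Nat using (_+_; _*_; _≤_; _∸_)

  1≤h : 1 ≤ h
  1≤h = ℕₚ.≤-trans (s≤s z≤n) 2≤h

  open Torus h h 1≤h 1≤h
  open TorusConvexSets h h 1≤h 1≤h

  A A' B : V G
  A  = (X 0 , Y 0)
  A' = (X 0 , Y 1)
  B  = (X 0 , Y (h + 1))

  B+h≡A : Y (h + (h + 1)) ≡ Y 0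
  B+h≡A = trans (cong Y (once-around h)) (C₂.pos-around 0)
    where
    once-around : ∀ h → h + (h + 1) ≡ suc (0 + 2 * h)
    once-around = ℕ-solver.solve-∀

  hull : IsHullSet G (A ∷ A' ∷ B ∷ [])
  hull T convex contains = full-column T convex 2≤h 0 column₀
    where
    T-A : T (X 0 , Y (h + (h + 1)))
    T-A = subst (λ y → T (X 0 , y)) (sym B+h≡A) (contains A (here refl))
    T-A' : T A'
    T-A' = contains A' (there (here refl))
    T-B : T B
    T-B = contains B (there (there (here refl)))
    on-arcs : ∀ j → j ≤ 2 * h → T (X 0 , Y (j + 1))
    on-arcs j j≤2h with j ℕₚ.≤? h
    ... | yes j≤h = vertical-segment T convex (X 0) 1 h ℕₚ.≤-refl T-A' T-B j j≤h
    ... | no  j≰h = subst (λ i → T (X 0 , Y i)) (trans (sym (ℕₚ.+-assoc (j ∸ h) h 1)) (cong (_+ 1) (ℕₚ.m∸n+n≡m h≤j)))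
                      (vertical-segment T convex (X 0) (h + 1) h ℕₚ.≤-refl T-B T-A (j ∸ h)
                        (ℕₚ.m≤n+o⇒m∸n≤o j h (subst (j ≤_) (cong (h +_) (ℕₚ.+-identityʳ h)) j≤2h)))
      where
      h≤j : h ≤ j
      h≤j = ℕₚ.<⇒≤ (ℕₚ.≰⇒> j≰h)
    column₀ : ∀ y → T (X 0 , y)
    column₀ y with C₂.window 1 y
    ... | j , j≤2h , Y≡y = subst (λ w → T (X 0 , w)) Y≡y (on-arcs j j≤2h)

  distinct-A-A' : ¬ A ≡ A'
  distinct-A-A' eq = C₂.pos-distinct 0 1 (s≤s z≤n) 1≤h (cong proj₂ eq)

  distinct-A'-B : ¬ A' ≡ B
  distinct-A'-B eq = C₂.pos-distinct 1 h 1≤h ℕₚ.≤-refl (cong proj₂ eq)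

  distinct-A-B : ¬ A ≡ B
  distinct-A-B eq = C₂.pos-distinct (h + 1) h 1≤h ℕₚ.≤-refl (trans (sym (cong proj₂ eq)) (sym B+h≡A))

  hull-number : HullNumber G 3
  hull-number = ( A ∷ A' ∷ B ∷ []
                , (distinct-A-A' ∷ distinct-A-B ∷ []) ∷ (distinct-A'-B ∷ []) ∷ [] ∷ []
                , refl , hull)
              , λ S _ → GraphFacts.hull-set-size≥3 G A (SquareTorusIntervals.interval-proper h 1≤h) S

-- They are at
-- distance k, and two shortest A–B paths run along the diagonal and the
-- antidiagonal from A before going straight up to B.  Starting from these two
-- arms, common neighbours fill the cone {(x , y) | |x| ≤ y ≤ h}, whose top row is
-- a whole row of the torus.
module TwoVertexHull (h k : ℕ) (2≤h : 2 ℕ.≤ h) (h<k : h ℕ.< k) where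
  open import Data.List.Relation.Unary.All using ([]; _∷_)
  open import Data.List.Relation.Unary.AllPairs using ([]; _∷_)
  open import Data.Nat using (_+_; _*_; _≤_; _<_; _∸_)
  open import Data.List.Properties using (length-++)
  open import Data.List.Membership.Propositional.Properties using (∈-++⁺ˡ)

  1≤h : 1 ≤ h
  1≤h = ℕₚ.≤-trans (s≤s z≤n) 2≤h

  1≤k : 1 ≤ k
  1≤k = ℕₚ.≤-trans 1≤h (ℕₚ.<⇒≤ h<k)

  open Torus h k 1≤h 1≤k
  open TorusConvexSets h k 1≤h 1≤k
  open GraphFacts G

  A B : V G
  A = (X 0 , Y 0)
  B = (X h , Y k)

  distinct-A-B : ¬ A ≡ B
  distinct-A-B eq = C₁.pos-distinct 0 h 1≤h ℕₚ.≤-refl (trans (cong proj₁ eq) (cong X (sym (ℕₚ.+-identityʳ h))))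

  far-apart : ∀ ws → Walk G A B ws → suc k ≤ length ws
  far-apart ws walk = ℕₚ.≤-trans (s≤s k≤d) (walk-length≥ walk)
    where
    k≤d : k ≤ d A B
    k≤d = ℕₚ.≤-trans (ℕₚ.≤-reflexive (sym (subst (λ i → ∣ C₂.r (Y 0) (Y i) ∣ ≡ k) (ℕₚ.+-identityʳ k)
                                                 (C₂.∣r-pos∣ 0 k ℕₚ.≤-refl))))
                     (ℕₚ.m≤n⊔m _ _)

  module _ (T : V G → Set) (convex : Convex G T) (T-A : T A) (T-B : T B) where

    on-short-walk : ∀ {ws z} → Walk G A B ws → length ws ≤ suc k → z ∈ ws → T z
    on-short-walk walk short =
      shortest-path-closed T convex T-A T-B walk (λ ws w → ℕₚ.≤-trans short (far-apart ws w))

    module Up = Chain (λ t → (X h , Y t)) (vertical-edge (X h))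

    up-to-B : ∀ s → s ≤ k → Walk G (X h , Y s) B (Up.chain s (k ∸ s))
    up-to-B s s≤k = subst (λ j → Walk G (X h , Y s) (X h , Y j) (Up.chain s (k ∸ s))) (ℕₚ.m∸n+n≡m s≤k)
                          (Up.chain-walk s (k ∸ s))

    arm-length : ∀ vs s → length vs ≡ suc s → s ≤ k → length (vs ++ Up.chain-tail s (k ∸ s)) ≡ suc k
    arm-length vs s len s≤k = begin
      length (vs ++ Up.chain-tail s (k ∸ s))         ≡⟨ length-++ vs ⟩
      length vs + length (Up.chain-tail s (k ∸ s))   ≡⟨ cong₂ _+_ len (ℕₚ.suc-injective (Up.chain-length s (k ∸ s))) ⟩
      suc (s + (k ∸ s))                              ≡⟨ cong suc (ℕₚ.m+[n∸m]≡n s≤k) ⟩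
      suc k                                          ∎
      where open ≡-Reasoning

    module Diagonal = Chain (λ t → (X t , Y t)) (λ t → diagonal-edge t t)

    diagonal-arm : ∀ t → t ≤ h → T (X t , Y t)
    diagonal-arm t t≤h = subst (λ i → T (X i , Y i)) (ℕₚ.+-identityʳ t)
      (on-short-walk (to-corner ++ʷ up-to-B h (ℕₚ.<⇒≤ h<k))
                     (ℕₚ.≤-reflexive (arm-length (Diagonal.chain 0 h) h (Diagonal.chain-length 0 h) (ℕₚ.<⇒≤ h<k)))
                     (∈-++⁺ˡ (Diagonal.chain-member 0 h t t≤h)))
      where
      to-corner : Walk G A (X h , Y h) (Diagonal.chain 0 h)
      to-corner = subst (λ i → Walk G A (X i , Y i) (Diagonal.chain 0 h)) (ℕₚ.+-identityʳ h) (Diagonal.chain-walk 0 h)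

    -- The antidiagonal arm A, (-1 , 1), …, (-(h+1) , h+1) = (h , h+1); note that
    -- X (t · 2h) = X (-t).
    module Antidiagonal = Chain (λ t → (X (t * (2 * h)) , Y t))
                                (λ t → inj₂ (inj₂ (C₁.adjacent-pred (t * (2 * h)) , C₂.adjacent-suc t)))

    antidiagonal-arm : ∀ t → t ≤ suc h → T (X (t * (2 * h)) , Y t)
    antidiagonal-arm t t≤h+1 = subst (λ i → T (X (i * (2 * h)) , Y i)) (ℕₚ.+-identityʳ t)
      (on-short-walk (to-corner ++ʷ up-to-B (suc h) h<k)
                     (ℕₚ.≤-reflexive (arm-length (Antidiagonal.chain 0 (suc h)) (suc h) (Antidiagonal.chain-length 0 (suc h)) h<k))
                     (∈-++⁺ˡ (Antidiagonal.chain-member 0 (suc h) t t≤h+1)))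
      where
      corner : X ((suc h + 0) * (2 * h)) ≡ X h
      corner = trans (cong X (once-around h)) (C₁.pos-periodic h h)
        where
        once-around : ∀ h → (suc h + 0) * (2 * h) ≡ h + h * suc (2 * h)
        once-around = ℕ-solver.solve-∀
      to-corner : Walk G A (X h , Y (suc h)) (Antidiagonal.chain 0 (suc h))
      to-corner = subst₂ (λ x j → Walk G A (x , Y j) (Antidiagonal.chain 0 (suc h))) corner (ℕₚ.+-identityʳ (suc h))
                         (Antidiagonal.chain-walk 0 (suc h))

    two-right : ∀ a b → X (suc b + a * (2 * h)) ≡ X (2 + (b + suc a * (2 * h)))
    two-right a b = trans (sym (C₁.pos-periodic (suc b + a * (2 * h)) 1)) (cong X (rearrange a b h))
      where
      rearrange : ∀ a b h → suc b + a * (2 * h) + 1 * suc (2 * h) ≡ 2 + (b + suc a * (2 * h))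
      rearrange = ℕ-solver.solve-∀

    -- The cone points (b - a , a + b) with a + b ≤ h: the two arms for a = 0 or
    -- b = 0, and otherwise the common neighbour of (b - a - 1 , a + b - 1) and
    -- (b - a + 1 , a + b - 1).
    cone : ∀ a b → a + b ≤ h → T (X (b + a * (2 * h)) , Y (a + b))
    cone zero    b       a+b≤h = subst (λ i → T (X i , Y b)) (sym (ℕₚ.+-identityʳ b)) (diagonal-arm b a+b≤h)
    cone (suc a) zero    a+b≤h = subst (λ j → T (X (suc a * (2 * h)) , Y j)) (sym (ℕₚ.+-identityʳ (suc a)))
      (antidiagonal-arm (suc a) (ℕₚ.≤-trans (subst (_≤ h) (ℕₚ.+-identityʳ (suc a)) a+b≤h) (ℕₚ.n≤1+n h)))
    cone (suc a) (suc b) a+b≤h = subst (λ j → T (X (suc (b + suc a * (2 * h))) , Y j)) (cong suc (sym (ℕₚ.+-suc a b)))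
      (column-midpoint T convex 2≤h (cone (suc a) b (ℕₚ.≤-trans (s≤s (ℕₚ.+-monoʳ-≤ a (ℕₚ.n≤1+n b))) a+b≤h))
                                    (subst₂ (λ x j → T (x , Y j)) (two-right a b) (ℕₚ.+-suc a b)
                                            (cone a (suc b) (ℕₚ.≤-trans (ℕₚ.n≤1+n _) a+b≤h)))
                                    (diagonal-edge _ _) (antidiagonal-edge _ _))

    -- The cone points (b - a , a + b + 1) with a + b < h are horizontal midpoints.
    cone-odd : ∀ a b → suc (a + b) ≤ h → T (X (suc (b + suc a * (2 * h))) , Y (suc (a + b)))
    cone-odd a b a+b<h =
      column-midpoint T convex 2≤h (cone (suc a) b a+b<h)
                                   (subst₂ (λ x j → T (x , Y j)) (two-right a b) (ℕₚ.+-suc a b)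
                                           (cone a (suc b) (subst (_≤ h) (sym (ℕₚ.+-suc a b)) a+b<h)))
                                   (horizontal-edge _ _) (horizontal-edge _ _)

    top-row-even : ∀ a → a ≤ h → T (X (a + a + h * (2 * h)) , Y h)
    top-row-even a a≤h = subst₂ (λ x l → T (x , Y l)) X≡ c+a≡h (cone c a (ℕₚ.≤-reflexive c+a≡h))
      where
      c : ℕ
      c = h ∸ a
      c+a≡h : c + a ≡ h
      c+a≡h = ℕₚ.m∸n+n≡m a≤h
      rearrange : ∀ a c h → a + c * (2 * h) + a * suc (2 * h) ≡ a + a + (c + a) * (2 * h)
      rearrange = ℕ-solver.solve-∀
      X≡ : X (a + c * (2 * h)) ≡ X (a + a + h * (2 * h))
      X≡ = trans (sym (C₁.pos-periodic (a + c * (2 * h)) a))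
                 (cong X (trans (rearrange a c h) (cong (λ l → a + a + l * (2 * h)) c+a≡h)))

    top-row-odd : ∀ a → a < h → T (X (suc (a + a) + h * (2 * h)) , Y h)
    top-row-odd a a<h = subst₂ (λ x l → T (x , Y l)) X≡ c+a≡h (cone-odd c a (ℕₚ.≤-reflexive c+a≡h))
      where
      c : ℕ
      c = h ∸ suc a
      c+a≡h : suc (c + a) ≡ h
      c+a≡h = trans (sym (ℕₚ.+-suc c a)) (ℕₚ.m∸n+n≡m a<h)
      rearrange : ∀ a c h → suc (a + suc c * (2 * h)) + a * suc (2 * h) ≡ suc (a + a) + suc (c + a) * (2 * h)
      rearrange = ℕ-solver.solve-∀
      X≡ : X (suc (a + suc c * (2 * h))) ≡ X (suc (a + a) + h * (2 * h))
      X≡ = trans (sym (C₁.pos-periodic (suc (a + suc c * (2 * h))) a))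
                 (cong X (trans (rearrange a c h) (cong (λ l → suc (a + a) + l * (2 * h)) c+a≡h)))

    top-row : ∀ x → T (x , Y h)
    top-row x with C₁.window (h * (2 * h)) x
    ... | j , j≤2h , X≡x = subst (λ u → T (u , Y h)) X≡x (by-parity (halve j))
      where
      open Halving
      j≤h+h : j ≤ h + h
      j≤h+h = subst (j ≤_) (cong (h +_) (ℕₚ.+-identityʳ h)) j≤2h
      at : ∀ {i} → j ≡ i → T (X (i + h * (2 * h)) , Y h) → T (X (j + h * (2 * h)) , Y h)
      at j≡i = subst (λ i → T (X (i + h * (2 * h)) , Y h)) (sym j≡i)
      by-parity : ∃[ a ] (j ≡ a + a ⊎ j ≡ suc (a + a)) → T (X (j + h * (2 * h)) , Y h)
      by-parity (a , inj₁ j≡a+a)   = at j≡a+a (top-row-even a (half-≤ a h (subst (_≤ h + h) j≡a+a j≤h+h)))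
      by-parity (a , inj₂ j≡1+a+a) = at j≡1+a+a (top-row-odd a (half-< a h (subst (_≤ h + h) j≡1+a+a j≤h+h)))

  hull : IsHullSet G (A ∷ B ∷ [])
  hull T convex contains =
    full-row T convex 2≤h h (top-row T convex (contains A (here refl)) (contains B (there (here refl))))

  hull-number : HullNumber G 2
  hull-number = (A ∷ B ∷ [] , (distinct-A-B ∷ []) ∷ [] ∷ [] , refl , hull)
              , λ S _ → hull-set-size≥2 distinct-A-B S

open import Data.Nat using (_*_; _≤_; _<_)

proposition13 : (h k : ℕ) → 2 ≤ h → h ≤ k →
    (h < k → HullNumber (C (suc (2 * h)) ⊠ C (suc (2 * k))) 2)
    × (h ≡ k → HullNumber (C (suc (2 * h)) ⊠ C (suc (2 * k))) 3)
proposition13 h k 2≤h _ = (λ h<k → TwoVertexHull.hull-number h k 2≤h h<k)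
                        , (λ { refl → ThreeVertexHull.hull-number h 2≤h })
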